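{- We have $$I^{3\underline{12}}(x)=I^{3\underline{21}}(x)=1-\frac{1}{B(x)},$$ where $B(x)=\sum_{n\ge0}B_nx^n$ and $B_n$ is the $n$-th Bell number (the number of set partitions of $[n]$).
   Context: For a permutation $\pi=\pi_1\cdots\pi_n$ of $[n]$, let $i_\pi$ be the smallest index $i$ with $\{\pi_1,\dots,\pi_i\}=\{1,\dots,i\}$; $\pi$ is indecomposable if $i_\pi=n$ (the empty permutation is not indecomposable). A permutation $\pi$ contains the vincular pattern $3\underline{12}$ (resp. $3\underline{21}$) if there are indices $j<k<n$ with $\pi_k<\pi_{k+1}<\pi_j$ (resp. $\pi_{k+1}<\pi_k<\pi_j$); otherwise it avoids it. For a pattern $\sigma$, $I^\sigma_n$ is the number of $\sigma$-avoiding indecomposable permutations of $[n]$ and $I^\sigma(x)=\sum_{n\ge1}I^\sigma_nx^n$. -}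

module Defs where

open import Data.Bool using (Bool; true; false; _∧_; _∨_; not; if_then_else_)
open import Data.Nat using (ℕ; zero; suc; _+_; _*_; _∸_; _<ᵇ_; _≡ᵇ_)
open import Data.Fin using (Fin; toℕ)
open import Data.Vec using (Vec; []; _∷_; lookup)
open import Data.List using (List; []; _∷_; map; concatMap; length; filterᵇ; allFin; upTo)
open import Data.Bool.ListAction using (all; any)
open import Data.Nat.ListAction using (sum)

allVecs : {A : Set} → List A → (n : ℕ) → List (Vec A n)
allVecs xs zero = [] ∷ []
allVecs xs (suc n) = concatMap (λ x → map (x ∷_) (allVecs xs n)) xs

count : {A : Set} → (A → Bool) → List A → ℕ
count p xs = length (filterᵇ p xs)

-- A word π = π₁⋯πₙ over [n] is encoded as v : Vec (Fin n) n, with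
-- (0-based) position i holding the value toℕ (lookup v i) + 1.

isPerm : ∀ {n} → Vec (Fin n) n → Bool
isPerm {n} v = all (λ i → all (λ j → (toℕ i ≡ᵇ toℕ j) ∨ not (toℕ (lookup v i) ≡ᵇ toℕ (lookup v j))) (allFin n)) (allFin n)

-- {π₁,…,π_i} = {1,…,i}  (i ≥ 0; 0-based: the first i entries form the set {0,…,i-1}).
prefixIsInitial : ∀ {n} → Vec (Fin n) n → ℕ → Bool
prefixIsInitial {n} v i =
  all (λ p → not (toℕ p <ᵇ i) ∨ (toℕ (lookup v p) <ᵇ i)) (allFin n)
  ∧ all (λ a → not (toℕ a <ᵇ i) ∨ any (λ p → (toℕ p <ᵇ i) ∧ (toℕ (lookup v p) ≡ᵇ toℕ a)) (allFin n)) (allFin n)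

isIndecomposable : ∀ {n} → Vec (Fin n) n → Bool
isIndecomposable {zero} v = false
isIndecomposable {suc n} v = not (any (λ i → prefixIsInitial v (suc i)) (upTo n))

data Pattern : Set where
  p3-12 p3-21 : Pattern

-- values a = π_j, b = π_k, c = π_{k+1}
occ : Pattern → ℕ → ℕ → ℕ → Bool
occ p3-12 a b c = (b <ᵇ c) ∧ (c <ᵇ a)
occ p3-21 a b c = (c <ᵇ b) ∧ (b <ᵇ a)

contains : Pattern → ∀ {n} → Vec (Fin n) n → Bool
contains σ {n} v =
  any (λ j → any (λ k → any (λ k' →
      (toℕ j <ᵇ toℕ k) ∧ (toℕ k' ≡ᵇ suc (toℕ k))
      ∧ occ σ (toℕ (lookup v j)) (toℕ (lookup v k)) (toℕ (lookup v k')))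
    (allFin n)) (allFin n)) (allFin n)

avoids : Pattern → ∀ {n} → Vec (Fin n) n → Bool
avoids σ v = not (contains σ v)

I : Pattern → ℕ → ℕ
I σ n = count (λ v → isPerm v ∧ isIndecomposable v ∧ avoids σ v) (allVecs (allFin n) n)

-- Set partitions of [n], represented (bijectively) by their equivalence relations
-- R : Fin n → Fin n → Bool, encoded as an n×n Boolean matrix.
isEquivRel : ∀ {n} → Vec (Vec Bool n) n → Bool
isEquivRel {n} R =
  all (λ i → lookup (lookup R i) i) (allFin n)
  ∧ all (λ i → all (λ j → not (lookup (lookup R i) j) ∨ lookup (lookup R j) i) (allFin n)) (allFin n)
  ∧ all (λ i → all (λ j → all (λ k →
       not (lookup (lookup R i) j ∧ lookup (lookup R j) k) ∨ lookup (lookup R i) k)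
       (allFin n)) (allFin n)) (allFin n)

bell : ℕ → ℕ
bell n = count isEquivRel (allVecs (allVecs (true ∷ false ∷ []) n) n)

-- Coefficient of x^n in 1 (power series).
δ₀ : ℕ → ℕ
δ₀ zero = 1
δ₀ (suc _) = 0

-- Coefficient of x^n in I^σ(x)·B(x), where I^σ(x) = Σ_{k≥1} I^σ_k x^k.
IB : Pattern → ℕ → ℕ
IB σ n = sum (map (λ k → I σ (suc k) * bell (n ∸ suc k)) (upTo n))

module Submission where

-- Coefficientwise the identity reads B(n+1) = Σ_{k≤n} I^σ(k+1) B(n−k). Cutting a partition of
-- [n+1] at its least cut c (no block meets both [1,c] and [c+1,n+1]) gives a bijection with pairs
-- (atomic partition of [c], partition of [n+1−c]), atomic meaning "without a cut strictly inside";
-- so it suffices that atomic partitions of [k] and indecomposable σ-avoiders of length k are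
-- equinumerous. Both are in bijection with the inflationary idempotent maps m on [k] without cuts
-- (m [1,c] ⊆ [1,c]): a partition goes to the map sending a to the maximum of its block, a
-- permutation to the map sending a letter a to the largest letter written no later than a. Cuts of
-- the partition and decomposition points of the permutation are exactly the cuts of m. A σ-avoider
-- is recovered from its map m by sorting the letters by the key (m a, rank of a in its block), the
-- rank ordering a block decreasingly for 3_12 and as maximum-then-increasing for 3_21; conversely the
-- permutation sorted by this key avoids σ and has m as its map of left maxima.

open import Defs
open import Data.Bool using (Bool; true; false; _∧_; _∨_; not; T; if_then_else_)
open import Data.Bool.Properties using (T-∧; T-∨)
open import Data.Bool.ListAction using (all; any)
open import Data.Empty using (⊥; ⊥-elim)
open import Data.Fin using (Fin; toℕ; _↑ˡ_; _↑ʳ_; splitAt; cast; fromℕ<; inject≤; punchOut)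
import Data.Fin as Fin
open import Data.Fin.Properties
  using (toℕ-injective; toℕ<n; toℕ-↑ˡ; toℕ-↑ʳ; splitAt-↑ˡ; splitAt-↑ʳ; splitAt⁻¹-↑ˡ; splitAt⁻¹-↑ʳ; toℕ-cast; toℕ-fromℕ<; toℕ-inject≤; pigeonhole; punchOut-injective)
open import Data.List
  using (List; []; _∷_; map; concatMap; length; filterᵇ; allFin; upTo; applyUpTo; _++_; cartesianProduct; cartesianProductWith)
import Data.List as List
open import Data.List.Membership.Propositional using (_∈_; find; lose)
open import Data.List.Membership.Propositional.Properties
  using (∈-filter⁺; ∈-filter⁻; ∈-map⁺; ∈-map⁻; ∈-allFin; ∈-upTo⁺; ∈-upTo⁻; ∈-tabulate⁺; ∈-lookup; ∈-cartesianProduct⁺; ∈-cartesianProductWith⁺)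
open import Data.List.Membership.Propositional.Properties.WithK using (unique∧set⇒bag)
open import Data.List.Properties using (length-map; length-++; length-tabulate; filter-++; map-applyUpTo)
open import Data.List.Relation.Binary.BagAndSetEquality using (∼bag⇒↭)
open import Data.List.Relation.Binary.Permutation.Propositional using (_↭_; ↭-sym; ↭-trans; ↭⇒↭ₛ′; ↭⇒↭ₛ)
open import Data.List.Relation.Binary.Permutation.Propositional.Properties using (↭-length)
import Data.List.Relation.Binary.Permutation.Setoid.Properties as Permutationₛ
open import Data.List.Relation.Binary.Pointwise as Pointwise using (Pointwise)
open import Data.List.Relation.Unary.All as All using (All; []; _∷_)
open import Data.List.Relation.Unary.All.Properties using (all⁺; all⁻; all-filter)
open import Data.List.Relation.Unary.AllPairs using ([]; _∷_)
open import Data.List.Relation.Unary.Any as Any using (here; there)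
open import Data.List.Relation.Unary.Any.Properties using (any⁺; any⁻)
open import Data.List.Relation.Unary.Linked using (Linked; []; [-]; _∷_)
open import Data.List.Relation.Unary.Sorted.TotalOrder.Properties using (↗↭↗⇒≋; lookup-mono-≤)
open import Data.List.Relation.Unary.Unique.Propositional using (Unique)
import Data.List.Relation.Unary.Unique.Propositional.Properties as Unique
import Data.List.Sort as Sort
open import Data.Nat using (ℕ; zero; suc; _+_; _*_; _∸_; _<_; _≤_; _<ᵇ_; _≡ᵇ_; z≤n; s≤s)
open import Data.Nat.ListAction using (sum)
open import Data.Nat.Properties
open import Algebra.Properties.CommutativeSemigroup +-commutativeSemigroup using (interchange)
open import Data.List.Extrema ≤-totalOrder using (argmax; v≤f[argmax]⁺)
open import Data.Product using (∃; ∃₂; _×_; _,_; proj₁; proj₂)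
open import Data.Sum using (_⊎_; inj₁; inj₂; [_,_]′)
open import Data.Vec using (Vec; []; _∷_; lookup; tabulate)
open import Data.Vec.Properties using (∷-injective; lookup∘tabulate; tabulate∘lookup; tabulate-cong)
open import Function using (_∘_; _∘′_; id)
open import Function.Bundles using (Equivalence; mk⇔)
open import Relation.Binary.Bundles using (DecTotalOrder; TotalOrder)
import Relation.Binary.Construct.On as On
open import Relation.Binary.Definitions using (tri<; tri≈; tri>)
open import Relation.Binary.PropositionalEquality using (_≡_; _≢_; refl; sym; trans; cong; cong₂; subst; subst₂; setoid)
open import Relation.Nullary using (¬_; contradiction)
open import Relation.Nullary.Decidable using (T?)

open Relation.Binary.PropositionalEquality.≡-Reasoning

private
  variable
    A B : Set

T-∧⁺ : ∀ {a b} → T a → T b → T (a ∧ b)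
T-∧⁺ x y = Equivalence.from T-∧ (x , y)

T-∧⁻ : ∀ {a b} → T (a ∧ b) → T a × T b
T-∧⁻ {a} = Equivalence.to (T-∧ {a})

T-∨⁻ : ∀ {a b} → T (a ∨ b) → T a ⊎ T b
T-∨⁻ {a} = Equivalence.to (T-∨ {a})

T-not⁺ : ∀ {a} → ¬ T a → T (not a)
T-not⁺ {true} f = f _
T-not⁺ {false} _ = _

T-not⁻ : ∀ {a} → T (not a) → ¬ T a
T-not⁻ {true} ()

T-imp⁺ : ∀ {a b} → (T a → T b) → T (not a ∨ b)
T-imp⁺ {true} f = f _
T-imp⁺ {false} _ = _

T-imp⁻ : ∀ {a b} → T (not a ∨ b) → T a → T b
T-imp⁻ {true} h _ = h

T-extensional : ∀ {a b} → (T a → T b) → (T b → T a) → a ≡ b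
T-extensional {true} {true} _ _ = refl
T-extensional {true} {false} f _ = ⊥-elim (f _)
T-extensional {false} {true} _ g = ⊥-elim (g _)
T-extensional {false} {false} _ _ = refl

toℕ-≡ᵇ⁺ : ∀ {n} {x y : Fin n} → x ≡ y → T (toℕ x ≡ᵇ toℕ y)
toℕ-≡ᵇ⁺ e = ≡⇒≡ᵇ _ _ (cong toℕ e)

toℕ-≡ᵇ⁻ : ∀ {n} {x y : Fin n} → T (toℕ x ≡ᵇ toℕ y) → x ≡ y
toℕ-≡ᵇ⁻ t = toℕ-injective (≡ᵇ⇒≡ _ _ t)

all-allFin⁻ : ∀ {n} (p : Fin n → Bool) → T (all p (allFin n)) → ∀ i → T (p i)
all-allFin⁻ p h i = All.lookup (all⁺ p _ h) (∈-allFin i)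

all-allFin⁺ : ∀ {n} (p : Fin n → Bool) → (∀ i → T (p i)) → T (all p (allFin n))
all-allFin⁺ p h = all⁻ p {xs = allFin _} (All.tabulate λ {i} _ → h i)

any-allFin⁻ : ∀ {n} (p : Fin n → Bool) → T (any p (allFin n)) → ∃ λ i → T (p i)
any-allFin⁻ {n} p h = Any.satisfied (any⁻ p (allFin n) h)

any-allFin⁺ : ∀ {n} (p : Fin n → Bool) i → T (p i) → T (any p (allFin n))
any-allFin⁺ {n} p i t = any⁺ {xs = allFin n} p (Any.map (λ { refl → t }) (∈-allFin i))

any-cong : ∀ (p q : A → Bool) xs → (∀ x → x ∈ xs → p x ≡ q x) → any p xs ≡ any q xs
any-cong p q [] e = refl
any-cong p q (x ∷ xs) e = cong₂ _∨_ (e x (here refl)) (any-cong p q xs (λ y y∈ → e y (there y∈)))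

indicator : Bool → ℕ
indicator true = 1
indicator false = 0

count-∷ : ∀ (p : A → Bool) x xs → count p (x ∷ xs) ≡ indicator (p x) + count p xs
count-∷ p x xs with p x
... | true = refl
... | false = refl

count-++ : ∀ (p : A → Bool) xs ys → count p (xs ++ ys) ≡ count p xs + count p ys
count-++ p xs ys = trans (cong length (filter-++ (T? ∘ p) xs ys)) (length-++ (filterᵇ p xs))

count-map : ∀ (p : B → Bool) (f : A → B) xs → count p (map f xs) ≡ count (p ∘ f) xs
count-map p f [] = refl
count-map p f (x ∷ xs) = begin
  count p (f x ∷ map f xs)                 ≡⟨ count-∷ p (f x) (map f xs) ⟩
  indicator (p (f x)) + count p (map f xs) ≡⟨ cong (indicator (p (f x)) +_) (count-map p f xs) ⟩
  indicator (p (f x)) + count (p ∘ f) xs   ≡⟨ count-∷ (p ∘ f) x xs ⟨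
  count (p ∘ f) (x ∷ xs)                   ∎

count-cong : ∀ (p q : A → Bool) xs → (∀ x → p x ≡ q x) → count p xs ≡ count q xs
count-cong p q [] e = refl
count-cong p q (x ∷ xs) e = begin
  count p (x ∷ xs)                 ≡⟨ count-∷ p x xs ⟩
  indicator (p x) + count p xs     ≡⟨ cong₂ _+_ (cong indicator (e x)) (count-cong p q xs e) ⟩
  indicator (q x) + count q xs     ≡⟨ count-∷ q x xs ⟨
  count q (x ∷ xs)                 ∎

count-false : ∀ (xs : List A) → count (λ _ → false) xs ≡ 0
count-false [] = refl
count-false (x ∷ xs) = count-false xs

count-cartesianProduct : ∀ {A B : Set} (p : A → Bool) (q : B → Bool) xs ys →
  count (λ z → p (proj₁ z) ∧ q (proj₂ z)) (cartesianProduct xs ys) ≡ count p xs * count q ys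
count-cartesianProduct p q [] ys = refl
count-cartesianProduct {A} {B} p q (x ∷ xs) ys = begin
  count pq (map (x ,_) ys ++ cartesianProduct xs ys)
    ≡⟨ count-++ pq (map (x ,_) ys) (cartesianProduct xs ys) ⟩
  count pq (map (x ,_) ys) + count pq (cartesianProduct xs ys)
    ≡⟨ cong₂ _+_ (trans (count-map pq (x ,_) ys) (row (p x))) (count-cartesianProduct p q xs ys) ⟩
  indicator (p x) * count q ys + count p xs * count q ys
    ≡⟨ *-distribʳ-+ (count q ys) (indicator (p x)) (count p xs) ⟨
  (indicator (p x) + count p xs) * count q ys
    ≡⟨ cong (_* count q ys) (count-∷ p x xs) ⟨
  count p (x ∷ xs) * count q ys ∎
  where
  pq : A × B → Bool
  pq z = p (proj₁ z) ∧ q (proj₂ z)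
  row : ∀ b → count (λ y → b ∧ q y) ys ≡ indicator b * count q ys
  row true = sym (+-identityʳ _)
  row false = count-false ys

Unique-map⁺-on : ∀ (P : A → Set) (f : A → B) {xs} → Unique xs → All P xs →
  (∀ {a a′} → P a → P a′ → f a ≡ f a′ → a ≡ a′) → Unique (map f xs)
Unique-map⁺-on P f [] [] inj = []
Unique-map⁺-on P f (x∉ ∷ u) (px ∷ ps) inj = distinct px x∉ ps ∷ Unique-map⁺-on P f u ps inj
  where
  distinct : ∀ {x ys} → P x → All (λ y → ¬ x ≡ y) ys → All P ys → All (λ y → ¬ f x ≡ y) (map f ys)
  distinct px [] [] = []
  distinct px (x≢y ∷ ns) (py ∷ ps′) = (λ e → x≢y (inj px py e)) ∷ distinct px ns ps′

count-bijection : ∀ (p : A → Bool) (q : B → Bool) {xs : List A} {ys : List B} →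
  Unique xs → Unique ys → (∀ x → x ∈ xs) → (∀ y → y ∈ ys) →
  (f : A → B) →
  (∀ x → T (p x) → T (q (f x))) →
  (∀ {x x′} → T (p x) → T (p x′) → f x ≡ f x′ → x ≡ x′) →
  (∀ y → T (q y) → ∃ λ x → T (p x) × f x ≡ y) →
  count p xs ≡ count q ys
count-bijection p q {xs} {ys} uxs uys all-xs all-ys f pres inj surj =
  trans (sym (length-map f (filterᵇ p xs))) (↭-length (∼bag⇒↭ (unique∧set⇒bag image-unique filter-unique (mk⇔ to from))))
  where
  image-unique : Unique (map f (filterᵇ p xs))
  image-unique = Unique-map⁺-on (T ∘ p) f (Unique.filter⁺ (T? ∘ p) uxs) (all-filter (T? ∘ p) xs) inj
  filter-unique : Unique (filterᵇ q ys)
  filter-unique = Unique.filter⁺ (T? ∘ q) uys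
  to : ∀ {y} → y ∈ map f (filterᵇ p xs) → y ∈ filterᵇ q ys
  to y∈ with ∈-map⁻ f y∈
  ... | x , x∈ , refl = ∈-filter⁺ (T? ∘ q) (all-ys (f x)) (pres x (proj₂ (∈-filter⁻ (T? ∘ p) {xs = xs} x∈)))
  from : ∀ {y} → y ∈ filterᵇ q ys → y ∈ map f (filterᵇ p xs)
  from {y} y∈ with surj y (proj₂ (∈-filter⁻ (T? ∘ q) {xs = ys} y∈))
  ... | x , px , refl = ∈-map⁺ f (∈-filter⁺ (T? ∘ p) (all-xs x) px)

allVecs-suc : ∀ (xs : List A) n → allVecs xs (suc n) ≡ cartesianProductWith _∷_ xs (allVecs xs n)
allVecs-suc xs n = prepend-each xs
  where
  prepend-each : ∀ ys → concatMap (λ y → map (y ∷_) (allVecs xs n)) ys ≡ cartesianProductWith _∷_ ys (allVecs xs n)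
  prepend-each [] = refl
  prepend-each (y ∷ ys) = cong (map (y ∷_) (allVecs xs n) ++_) (prepend-each ys)

∈-allVecs : ∀ {xs : List A} → (∀ x → x ∈ xs) → ∀ {n} (v : Vec A n) → v ∈ allVecs xs n
∈-allVecs all-xs [] = here refl
∈-allVecs {xs = xs} all-xs {suc n} (x ∷ v) =
  subst (x ∷ v ∈_) (sym (allVecs-suc xs n)) (∈-cartesianProductWith⁺ _∷_ (all-xs x) (∈-allVecs all-xs v))

allVecs-unique : ∀ {xs : List A} → Unique xs → ∀ n → Unique (allVecs xs n)
allVecs-unique u zero = [] ∷ []
allVecs-unique {xs = xs} u (suc n) =
  subst Unique (sym (allVecs-suc xs n)) (Unique.cartesianProductWith⁺ _∷_ ∷-injective u (allVecs-unique u n))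

sum-applyUpTo-+ : ∀ (f g : ℕ → ℕ) n →
  sum (applyUpTo (λ k → f k + g k) n) ≡ sum (applyUpTo f n) + sum (applyUpTo g n)
sum-applyUpTo-+ f g zero = refl
sum-applyUpTo-+ f g (suc n) =
  trans (cong (f 0 + g 0 +_) (sum-applyUpTo-+ (f ∘ suc) (g ∘ suc) n)) (interchange (f 0) (g 0) _ _)

sum-applyUpTo-cong : ∀ (f g : ℕ → ℕ) n → (∀ k → k < n → f k ≡ g k) →
  sum (applyUpTo f n) ≡ sum (applyUpTo g n)
sum-applyUpTo-cong f g zero e = refl
sum-applyUpTo-cong f g (suc n) e =
  cong₂ _+_ (e 0 (s≤s z≤n)) (sum-applyUpTo-cong (f ∘ suc) (g ∘ suc) n (λ k k< → e (suc k) (s≤s k<)))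

sum-applyUpTo-0 : ∀ n → sum (applyUpTo (λ _ → 0) n) ≡ 0
sum-applyUpTo-0 zero = refl
sum-applyUpTo-0 (suc n) = sum-applyUpTo-0 n

sum-applyUpTo-indicator : ∀ b v n → (T b → v < n) →
  sum (applyUpTo (λ k → indicator (b ∧ (v ≡ᵇ k))) n) ≡ indicator b
sum-applyUpTo-indicator false v n _ = sum-applyUpTo-0 n
sum-applyUpTo-indicator true v zero v<0 with () ← v<0 _
sum-applyUpTo-indicator true zero (suc n) _ = cong suc (sum-applyUpTo-0 n)
sum-applyUpTo-indicator true (suc v) (suc n) v<n =
  sum-applyUpTo-indicator true v n (λ t → ≤-pred (v<n t))

count-fibres : ∀ {A : Set} (p : A → Bool) (h : A → ℕ) n → (∀ x → T (p x) → h x < n) → ∀ xs →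
  count p xs ≡ sum (applyUpTo (λ k → count (λ x → p x ∧ (h x ≡ᵇ k)) xs) n)
count-fibres p h n h< [] = sym (sum-applyUpTo-0 n)
count-fibres {A} p h n h< (x ∷ xs) = begin
  count p (x ∷ xs)
    ≡⟨ count-∷ p x xs ⟩
  indicator (p x) + count p xs
    ≡⟨ cong₂ _+_ (sym (sum-applyUpTo-indicator (p x) (h x) n (h< x))) (count-fibres p h n h< xs) ⟩
  sum (applyUpTo (λ k → indicator (p x ∧ (h x ≡ᵇ k))) n) + sum (applyUpTo (λ k → count (fibre k) xs) n)
    ≡⟨ sum-applyUpTo-+ _ _ n ⟨
  sum (applyUpTo (λ k → indicator (p x ∧ (h x ≡ᵇ k)) + count (fibre k) xs) n)
    ≡⟨ sum-applyUpTo-cong _ _ n (λ k _ → sym (count-∷ (fibre k) x xs)) ⟩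
  sum (applyUpTo (λ k → count (fibre k) (x ∷ xs)) n) ∎
  where
  fibre : ℕ → A → Bool
  fibre k x = p x ∧ (h x ≡ᵇ k)

-- Set partitions and the first-cut decomposition

lookup-ext : ∀ {A : Set} {n} (u v : Vec A n) → (∀ i → lookup u i ≡ lookup v i) → u ≡ v
lookup-ext u v e = trans (sym (tabulate∘lookup u)) (trans (tabulate-cong e) (tabulate∘lookup v))

Relation : ℕ → Set
Relation n = Vec (Vec Bool n) n

related : ∀ {n} → Relation n → Fin n → Fin n → Bool
related R i j = lookup (lookup R i) j

relation-ext : ∀ {n} (R S : Relation n) → (∀ i j → related R i j ≡ related S i j) → R ≡ S
relation-ext R S e = lookup-ext R S (λ i → lookup-ext _ _ (e i))

related-tabulate : ∀ {n} (f : Fin n → Fin n → Bool) i j → related (tabulate λ i → tabulate (f i)) i j ≡ f i j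
related-tabulate f i j = trans (cong (λ row → lookup row j) (lookup∘tabulate _ i)) (lookup∘tabulate _ j)

allRelations : ∀ n → List (Relation n)
allRelations n = allVecs (allVecs (true ∷ false ∷ []) n) n

∈-allRelations : ∀ {n} (R : Relation n) → R ∈ allRelations n
∈-allRelations = ∈-allVecs (∈-allVecs ∈-bools)
  where
  ∈-bools : ∀ b → b ∈ true ∷ false ∷ []
  ∈-bools true = here refl
  ∈-bools false = there (here refl)

allRelations-unique : ∀ n → Unique (allRelations n)
allRelations-unique n = allVecs-unique (allVecs-unique (((λ ()) ∷ []) ∷ [] ∷ []) n) n

record IsEquivRel {n} (R : Relation n) : Set where
  field
    reflexive : ∀ i → T (related R i i)
    symmetric : ∀ i j → T (related R i j) → T (related R j i)
    transitive : ∀ i j k → T (related R i j) → T (related R j k) → T (related R i k)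

module _ {n} (R : Relation n) where
  private
    reflexiveᵇ symmetricᵇ transitiveᵇ : Bool
    reflexiveᵇ = all (λ i → related R i i) (allFin n)
    symmetricᵇ = all (λ i → all (λ j → not (related R i j) ∨ related R j i) (allFin n)) (allFin n)
    transitiveᵇ = all (λ i → all (λ j → all (λ k →
      not (related R i j ∧ related R j k) ∨ related R i k) (allFin n)) (allFin n)) (allFin n)

  isEquivRel-sound : T (isEquivRel R) → IsEquivRel R
  isEquivRel-sound h = record
    { reflexive = all-allFin⁻ _ refl-h
    ; symmetric = λ i j → T-imp⁻ (all-allFin⁻ _ (all-allFin⁻ _ sym-h i) j)
    ; transitive = λ i j k t u →
        T-imp⁻ {related R i j ∧ related R j k} (all-allFin⁻ _ (all-allFin⁻ _ (all-allFin⁻ _ trans-h i) j) k) (T-∧⁺ t u)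
    }
    where
    refl-h : T reflexiveᵇ
    refl-h = proj₁ (T-∧⁻ h)
    sym-h : T symmetricᵇ
    sym-h = proj₁ (T-∧⁻ (proj₂ (T-∧⁻ {reflexiveᵇ} h)))
    trans-h : T transitiveᵇ
    trans-h = proj₂ (T-∧⁻ {symmetricᵇ} (proj₂ (T-∧⁻ {reflexiveᵇ} h)))

  isEquivRel-complete : IsEquivRel R → T (isEquivRel R)
  isEquivRel-complete e = T-∧⁺ (all-allFin⁺ _ reflexive)
    (T-∧⁺ (all-allFin⁺ _ λ i → all-allFin⁺ _ λ j → T-imp⁺ (symmetric i j))
          (all-allFin⁺ _ λ i → all-allFin⁺ _ λ j → all-allFin⁺ _ λ k → T-imp⁺ {related R i j ∧ related R j k}
             λ t → transitive i j k (proj₁ (T-∧⁻ t)) (proj₂ (T-∧⁻ {related R i j} t))))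
    where open IsEquivRel e

restrict-IsEquivRel : ∀ {m n} (R : Relation n) (S : Relation m) (h : Fin m → Fin n) →
  (∀ a b → related S a b ≡ related R (h a) (h b)) → IsEquivRel R → IsEquivRel S
restrict-IsEquivRel R S h e E = record
  { reflexive = λ a → subst T (sym (e a a)) (reflexive (h a))
  ; symmetric = λ a b t → subst T (sym (e b a)) (symmetric _ _ (subst T (e a b) t))
  ; transitive = λ a b c t u → subst T (sym (e a c)) (transitive _ _ _ (subst T (e a b) t) (subst T (e b c) u))
  }
  where open IsEquivRel E

Cut : ∀ {n} → Relation n → ℕ → Set
Cut R c = ∀ i j → toℕ i < c → c ≤ toℕ j → ¬ T (related R i j)

isCut : ∀ {n} → Relation n → ℕ → Bool
isCut {n} R c = all (λ i → all (λ j → not ((toℕ i <ᵇ c) ∧ not (toℕ j <ᵇ c)) ∨ not (related R i j)) (allFin n)) (allFin n)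

isCut-sound : ∀ {n} (R : Relation n) c → T (isCut R c) → Cut R c
isCut-sound R c h i j i<c c≤j =
  T-not⁻ (T-imp⁻ {(toℕ i <ᵇ c) ∧ not (toℕ j <ᵇ c)} (all-allFin⁻ _ (all-allFin⁻ _ h i) j)
    (T-∧⁺ (<⇒<ᵇ i<c) (T-not⁺ λ j<c → <⇒≱ (<ᵇ⇒< _ _ j<c) c≤j)))

isCut-complete : ∀ {n} (R : Relation n) c → Cut R c → T (isCut R c)
isCut-complete R c h = all-allFin⁺ _ λ i → all-allFin⁺ _ λ j → T-imp⁺ {(toℕ i <ᵇ c) ∧ not (toℕ j <ᵇ c)} λ t →
  T-not⁺ (h i j (<ᵇ⇒< _ _ (proj₁ (T-∧⁻ t))) (≮⇒≥ λ j<c → T-not⁻ (proj₂ (T-∧⁻ {toℕ i <ᵇ c} t)) (<⇒<ᵇ j<c)))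

Cut-size : ∀ {n} (R : Relation n) → Cut R n
Cut-size {n} R i j _ n≤j _ = <⇒≱ (toℕ<n j) n≤j

isAtomic : ∀ {n} → Relation n → Bool
isAtomic {zero} R = false
isAtomic {suc n} R = not (any (λ i → isCut R (suc i)) (upTo n))

atomicCount : ℕ → ℕ
atomicCount n = count (λ R → isEquivRel R ∧ isAtomic R) (allRelations n)

-- The least i < k with P i (or k if there is none).
firstTrue : (ℕ → Bool) → ℕ → ℕ
firstTrue P zero = 0
firstTrue P (suc k) = if P 0 then 0 else suc (firstTrue (λ i → P (suc i)) k)

firstTrue-satisfies : ∀ (P : ℕ → Bool) k j → j < k → T (P j) → firstTrue P k < k × T (P (firstTrue P k))
firstTrue-satisfies P (suc k) j j<k t with P 0 in eq
... | true = s≤s z≤n , subst T (sym eq) _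
firstTrue-satisfies P (suc k) zero j<k t | false = ⊥-elim (subst T eq t)
firstTrue-satisfies P (suc k) (suc j) (s≤s j<k) t | false
  with firstTrue-satisfies (λ i → P (suc i)) k j j<k t
... | lt , sat = s≤s lt , sat

firstTrue-minimal : ∀ (P : ℕ → Bool) k i → i < firstTrue P k → ¬ T (P i)
firstTrue-minimal P (suc k) i i< t with P 0 in eq
firstTrue-minimal P (suc k) i () t | true
firstTrue-minimal P (suc k) zero i< t | false = subst T eq t
firstTrue-minimal P (suc k) (suc i) (s≤s i<) t | false = firstTrue-minimal (λ i → P (suc i)) k i i< t

firstTrue-unique : ∀ (P : ℕ → Bool) k c → c < k → T (P c) → (∀ i → i < c → ¬ T (P i)) → firstTrue P k ≡ c
firstTrue-unique P k c c<k t below with firstTrue-satisfies P k c c<k t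
... | _ , sat with <-cmp (firstTrue P k) c
... | tri< lt _ _ = ⊥-elim (below _ lt sat)
... | tri≈ _ eq _ = eq
... | tri> _ _ gt = ⊥-elim (firstTrue-minimal P k c gt t)

-- firstCut R = c - 1 for the least cut c ≥ 1 of R.
firstCut : ∀ {n} → Relation n → ℕ
firstCut {n} R = firstTrue (λ i → isCut R (suc i)) n

firstCut< : ∀ {n} (R : Relation (suc n)) → firstCut R < suc n
firstCut< {n} R = proj₁ (firstTrue-satisfies (λ i → isCut R (suc i)) (suc n) n ≤-refl (isCut-complete R (suc n) (Cut-size R)))

module _ (c d : ℕ) where
  data SplitView : Fin (c + d) → Set where
    left : (a : Fin c) → SplitView (a ↑ˡ d)
    right : (b : Fin d) → SplitView (c ↑ʳ b)

  splitView : ∀ i → SplitView i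
  splitView i with splitAt c i in eq
  ... | inj₁ a = subst SplitView (splitAt⁻¹-↑ˡ eq) (left a)
  ... | inj₂ b = subst SplitView (splitAt⁻¹-↑ʳ eq) (right b)

  toℕ-↑ˡ< : ∀ (a : Fin c) → toℕ (a ↑ˡ d) < c
  toℕ-↑ˡ< a = subst (_< c) (sym (toℕ-↑ˡ a d)) (toℕ<n a)

  ≤toℕ-↑ʳ : ∀ (b : Fin d) → c ≤ toℕ (c ↑ʳ b)
  ≤toℕ-↑ʳ b = subst (c ≤_) (sym (toℕ-↑ʳ c b)) (m≤m+n c (toℕ b))

  topLeft : Relation (c + d) → Relation c
  topLeft R = tabulate λ a → tabulate λ b → related R (a ↑ˡ d) (b ↑ˡ d)

  bottomRight : Relation (c + d) → Relation d
  bottomRight R = tabulate λ a → tabulate λ b → related R (c ↑ʳ a) (c ↑ʳ b)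

  related-topLeft : ∀ R a b → related (topLeft R) a b ≡ related R (a ↑ˡ d) (b ↑ˡ d)
  related-topLeft R = related-tabulate (λ a b → related R (a ↑ˡ d) (b ↑ˡ d))

  related-bottomRight : ∀ R a b → related (bottomRight R) a b ≡ related R (c ↑ʳ a) (c ↑ʳ b)
  related-bottomRight R = related-tabulate (λ a b → related R (c ↑ʳ a) (c ↑ʳ b))

  private
    blockEntry : Relation c → Relation d → Fin c ⊎ Fin d → Fin c ⊎ Fin d → Bool
    blockEntry X Y (inj₁ a) (inj₁ b) = related X a b
    blockEntry X Y (inj₂ a) (inj₂ b) = related Y a b
    blockEntry X Y _ _ = false

  blockDiagonal : Relation c → Relation d → Relation (c + d)
  blockDiagonal X Y = tabulate λ i → tabulate λ j → blockEntry X Y (splitAt c i) (splitAt c j)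

  module _ (X : Relation c) (Y : Relation d) where
    private
      related-blockDiagonal : ∀ i j → related (blockDiagonal X Y) i j ≡ blockEntry X Y (splitAt c i) (splitAt c j)
      related-blockDiagonal = related-tabulate (λ i j → blockEntry X Y (splitAt c i) (splitAt c j))

    related-blockDiagonal-ll : ∀ a b → related (blockDiagonal X Y) (a ↑ˡ d) (b ↑ˡ d) ≡ related X a b
    related-blockDiagonal-ll a b rewrite related-blockDiagonal (a ↑ˡ d) (b ↑ˡ d) | splitAt-↑ˡ c a d | splitAt-↑ˡ c b d = refl

    related-blockDiagonal-lr : ∀ a b → related (blockDiagonal X Y) (a ↑ˡ d) (c ↑ʳ b) ≡ false
    related-blockDiagonal-lr a b rewrite related-blockDiagonal (a ↑ˡ d) (c ↑ʳ b) | splitAt-↑ˡ c a d | splitAt-↑ʳ c d b = refl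

    related-blockDiagonal-rl : ∀ a b → related (blockDiagonal X Y) (c ↑ʳ a) (b ↑ˡ d) ≡ false
    related-blockDiagonal-rl a b rewrite related-blockDiagonal (c ↑ʳ a) (b ↑ˡ d) | splitAt-↑ʳ c d a | splitAt-↑ˡ c b d = refl

    related-blockDiagonal-rr : ∀ a b → related (blockDiagonal X Y) (c ↑ʳ a) (c ↑ʳ b) ≡ related Y a b
    related-blockDiagonal-rr a b rewrite related-blockDiagonal (c ↑ʳ a) (c ↑ʳ b) | splitAt-↑ʳ c d a | splitAt-↑ʳ c d b = refl

    topLeft-blockDiagonal : topLeft (blockDiagonal X Y) ≡ X
    topLeft-blockDiagonal = relation-ext _ _ λ a b → trans (related-topLeft (blockDiagonal X Y) a b) (related-blockDiagonal-ll a b)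

    bottomRight-blockDiagonal : bottomRight (blockDiagonal X Y) ≡ Y
    bottomRight-blockDiagonal = relation-ext _ _ λ a b → trans (related-bottomRight (blockDiagonal X Y) a b) (related-blockDiagonal-rr a b)

    blockDiagonal-IsEquivRel : IsEquivRel X → IsEquivRel Y → IsEquivRel (blockDiagonal X Y)
    blockDiagonal-IsEquivRel EX EY = record { reflexive = rf ; symmetric = sy ; transitive = tr }
      where
      XY : Relation (c + d)
      XY = blockDiagonal X Y
      module EX = IsEquivRel EX
      module EY = IsEquivRel EY
      no-lr : ∀ a b → ¬ T (related XY (a ↑ˡ d) (c ↑ʳ b))
      no-lr a b t = subst T (related-blockDiagonal-lr a b) t
      no-rl : ∀ a b → ¬ T (related XY (c ↑ʳ a) (b ↑ˡ d))
      no-rl a b t = subst T (related-blockDiagonal-rl a b) t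
      ll⁻ : ∀ {a b} → T (related XY (a ↑ˡ d) (b ↑ˡ d)) → T (related X a b)
      ll⁻ = subst T (related-blockDiagonal-ll _ _)
      ll⁺ : ∀ {a b} → T (related X a b) → T (related XY (a ↑ˡ d) (b ↑ˡ d))
      ll⁺ = subst T (sym (related-blockDiagonal-ll _ _))
      rr⁻ : ∀ {a b} → T (related XY (c ↑ʳ a) (c ↑ʳ b)) → T (related Y a b)
      rr⁻ = subst T (related-blockDiagonal-rr _ _)
      rr⁺ : ∀ {a b} → T (related Y a b) → T (related XY (c ↑ʳ a) (c ↑ʳ b))
      rr⁺ = subst T (sym (related-blockDiagonal-rr _ _))
      rf : ∀ i → T (related XY i i)
      rf i with splitView i
      ... | left a = ll⁺ (EX.reflexive a)
      ... | right b = rr⁺ (EY.reflexive b)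
      sy : ∀ i j → T (related XY i j) → T (related XY j i)
      sy i j t with splitView i | splitView j
      ... | left a | left b = ll⁺ (EX.symmetric a b (ll⁻ t))
      ... | right a | right b = rr⁺ (EY.symmetric a b (rr⁻ t))
      ... | left a | right b = ⊥-elim (no-lr a b t)
      ... | right a | left b = ⊥-elim (no-rl a b t)
      tr : ∀ i j k → T (related XY i j) → T (related XY j k) → T (related XY i k)
      tr i j k t u with splitView i | splitView j | splitView k
      ... | left a | left b | left e = ll⁺ (EX.transitive a b e (ll⁻ t) (ll⁻ u))
      ... | right a | right b | right e = rr⁺ (EY.transitive a b e (rr⁻ t) (rr⁻ u))
      ... | left a | right b | _ = ⊥-elim (no-lr a b t)
      ... | right a | left b | _ = ⊥-elim (no-rl a b t)
      ... | left a | left b | right e = ⊥-elim (no-lr b e u)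
      ... | right a | right b | left e = ⊥-elim (no-rl b e u)

module _ (c′ d : ℕ) where
  private
    c : ℕ
    c = suc c′
    cutAfter : Relation (c + d) → ℕ → Bool
    cutAfter R i = isCut R (suc i)

  FirstCutAt : Relation (c + d) → Bool
  FirstCutAt R = isEquivRel R ∧ (firstCut R ≡ᵇ c′)

  AtomicAndPartition : Relation c × Relation d → Bool
  AtomicAndPartition (X , Y) = (isEquivRel X ∧ isAtomic X) ∧ isEquivRel Y

  FirstCutAt-sound : ∀ R → T (FirstCutAt R) → IsEquivRel R × Cut R c × (∀ i → i < c′ → ¬ T (cutAfter R i))
  FirstCutAt-sound R h = isEquivRel-sound R (proj₁ (T-∧⁻ h)) , cut , below
    where
    first≡ : firstCut R ≡ c′
    first≡ = ≡ᵇ⇒≡ _ _ (proj₂ (T-∧⁻ {isEquivRel R} h))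
    cut : Cut R c
    cut = isCut-sound R c (subst (T ∘′ cutAfter R) first≡
      (proj₂ (firstTrue-satisfies (cutAfter R) (c + d) (c′ + d) ≤-refl (isCut-complete R (c + d) (Cut-size R)))))
    below : ∀ i → i < c′ → ¬ T (cutAfter R i)
    below i i< = firstTrue-minimal (cutAfter R) (c + d) i (subst (i <_) (sym first≡) i<)

  -- A cut of the top-left block below c is a cut of R, because c itself is a cut of R.
  topLeft-isAtomic : ∀ R → T (FirstCutAt R) → T (isAtomic (topLeft c d R))
  topLeft-isAtomic R h = T-not⁺ λ t → no-cut (find (any⁻ _ (upTo c′) t))
    where
    no-cut : (∃ λ i → i ∈ upTo c′ × T (isCut (topLeft c d R) (suc i))) → ⊥
    no-cut (i , i∈ , t) with FirstCutAt-sound R h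
    ... | _ , cut-c , no-cut-below = no-cut-below i i< (isCut-complete R (suc i) cut-R)
      where
      i< : i < c′
      i< = ∈-upTo⁻ i∈
      cut-X : Cut (topLeft c d R) (suc i)
      cut-X = isCut-sound (topLeft c d R) (suc i) t
      cut-R : Cut R (suc i)
      cut-R x y x< y≥ r with splitView c d x | splitView c d y
      ... | left a | left b = cut-X a b (subst (_< suc i) (toℕ-↑ˡ a d) x<) (subst (suc i ≤_) (toℕ-↑ˡ b d) y≥)
                                       (subst T (sym (related-topLeft c d R a b)) r)
      ... | left a | right b = cut-c _ _ (toℕ-↑ˡ< c d a) (≤toℕ-↑ʳ c d b) r
      ... | right a | _ = <⇒≱ (≤-trans x< (s≤s (<⇒≤ i<))) (≤toℕ-↑ʳ c d a)

  splitAtFirstCut-valid : ∀ R → T (FirstCutAt R) → T (AtomicAndPartition (topLeft c d R , bottomRight c d R))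
  splitAtFirstCut-valid R h =
    T-∧⁺ (T-∧⁺ (isEquivRel-complete (topLeft c d R) (restrict-IsEquivRel R _ (_↑ˡ d) (related-topLeft c d R) E))
               (topLeft-isAtomic R h))
         (isEquivRel-complete (bottomRight c d R) (restrict-IsEquivRel R _ (c ↑ʳ_) (related-bottomRight c d R) E))
    where
    E : IsEquivRel R
    E = proj₁ (FirstCutAt-sound R h)

  splitAtFirstCut-injective : ∀ {R R′} → T (FirstCutAt R) → T (FirstCutAt R′) →
    (topLeft c d R , bottomRight c d R) ≡ (topLeft c d R′ , bottomRight c d R′) → R ≡ R′
  splitAtFirstCut-injective {R} {R′} h h′ e with FirstCutAt-sound R h | FirstCutAt-sound R′ h′
  ... | E , cut , _ | E′ , cut′ , _ = relation-ext R R′ same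
    where
    same : ∀ i j → related R i j ≡ related R′ i j
    same i j with splitView c d i | splitView c d j
    ... | left a | left b = begin
      related R (a ↑ˡ d) (b ↑ˡ d)   ≡⟨ related-topLeft c d R a b ⟨
      related (topLeft c d R) a b   ≡⟨ cong (λ X → related X a b) (cong proj₁ e) ⟩
      related (topLeft c d R′) a b  ≡⟨ related-topLeft c d R′ a b ⟩
      related R′ (a ↑ˡ d) (b ↑ˡ d)  ∎
    ... | right a | right b = begin
      related R (c ↑ʳ a) (c ↑ʳ b)       ≡⟨ related-bottomRight c d R a b ⟨
      related (bottomRight c d R) a b   ≡⟨ cong (λ Y → related Y a b) (cong proj₂ e) ⟩
      related (bottomRight c d R′) a b  ≡⟨ related-bottomRight c d R′ a b ⟩
      related R′ (c ↑ʳ a) (c ↑ʳ b)      ∎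
    ... | left a | right b = T-extensional
      (λ t → ⊥-elim (cut _ _ (toℕ-↑ˡ< c d a) (≤toℕ-↑ʳ c d b) t))
      (λ t → ⊥-elim (cut′ _ _ (toℕ-↑ˡ< c d a) (≤toℕ-↑ʳ c d b) t))
    ... | right a | left b = T-extensional
      (λ t → ⊥-elim (cut _ _ (toℕ-↑ˡ< c d b) (≤toℕ-↑ʳ c d a) (IsEquivRel.symmetric E _ _ t)))
      (λ t → ⊥-elim (cut′ _ _ (toℕ-↑ˡ< c d b) (≤toℕ-↑ʳ c d a) (IsEquivRel.symmetric E′ _ _ t)))

  blockDiagonal-FirstCutAt : ∀ z → T (AtomicAndPartition z) → T (FirstCutAt (blockDiagonal c d (proj₁ z) (proj₂ z)))
  blockDiagonal-FirstCutAt (X , Y) h =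
    T-∧⁺ (isEquivRel-complete XY (blockDiagonal-IsEquivRel c d X Y (isEquivRel-sound X (proj₁ (T-∧⁻ hX))) (isEquivRel-sound Y hY)))
         (≡⇒≡ᵇ _ _ (firstTrue-unique (cutAfter XY) (c + d) c′ (s≤s (m≤m+n c′ d)) (isCut-complete XY c cut-c) no-cut-below))
    where
    XY : Relation (c + d)
    XY = blockDiagonal c d X Y
    hX : T (isEquivRel X ∧ isAtomic X)
    hX = proj₁ (T-∧⁻ h)
    hY : T (isEquivRel Y)
    hY = proj₂ (T-∧⁻ {isEquivRel X ∧ isAtomic X} h)
    cut-c : Cut XY c
    cut-c x y x< y≥ t with splitView c d x | splitView c d y
    ... | left a | right b = subst T (related-blockDiagonal-lr c d X Y a b) t
    ... | left a | left b = <⇒≱ (toℕ-↑ˡ< c d b) y≥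
    ... | right a | _ = <⇒≱ x< (≤toℕ-↑ʳ c d a)
    no-cut-below : ∀ i → i < c′ → ¬ T (cutAfter XY i)
    no-cut-below i i< t = T-not⁻ (proj₂ (T-∧⁻ {isEquivRel X} hX)) (any⁺ _ (lose (∈-upTo⁺ i<) (isCut-complete X (suc i) cut-X)))
      where
      cut-X : Cut X (suc i)
      cut-X a b a< b≥ r = isCut-sound XY (suc i) t (a ↑ˡ d) (b ↑ˡ d)
        (subst (_< suc i) (sym (toℕ-↑ˡ a d)) a<) (subst (suc i ≤_) (sym (toℕ-↑ˡ b d)) b≥)
        (subst T (sym (related-blockDiagonal-ll c d X Y a b)) r)

  count-FirstCutAt : count FirstCutAt (allRelations (c + d)) ≡ atomicCount c * bell d
  count-FirstCutAt = begin
    count FirstCutAt (allRelations (c + d))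
      ≡⟨ count-bijection FirstCutAt AtomicAndPartition
           (allRelations-unique (c + d)) (Unique.cartesianProduct⁺ (allRelations-unique c) (allRelations-unique d))
           ∈-allRelations (λ z → ∈-cartesianProduct⁺ (∈-allRelations (proj₁ z)) (∈-allRelations (proj₂ z)))
           (λ R → topLeft c d R , bottomRight c d R) splitAtFirstCut-valid splitAtFirstCut-injective
           (λ z h → blockDiagonal c d (proj₁ z) (proj₂ z) , blockDiagonal-FirstCutAt z h ,
                    cong₂ _,_ (topLeft-blockDiagonal c d _ _) (bottomRight-blockDiagonal c d _ _)) ⟩
    count AtomicAndPartition (cartesianProduct (allRelations c) (allRelations d))
      ≡⟨ count-cartesianProduct (λ X → isEquivRel X ∧ isAtomic X) isEquivRel (allRelations c) (allRelations d) ⟩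
    atomicCount c * bell d ∎

bell-suc : ∀ n → bell (suc n) ≡ sum (applyUpTo (λ k → atomicCount (suc k) * bell (n ∸ k)) (suc n))
bell-suc n = trans (count-fibres isEquivRel firstCut (suc n) (λ R _ → firstCut< R) (allRelations (suc n)))
  (sum-applyUpTo-cong _ _ (suc n) λ k k< → count-FirstCutAt-≡ k (n ∸ k) (cong suc (m+[n∸m]≡n (≤-pred k<))))
  where
  count-FirstCutAt-≡ : ∀ k d {m} → suc k + d ≡ m →
    count (λ R → isEquivRel R ∧ (firstCut R ≡ᵇ k)) (allRelations m) ≡ atomicCount (suc k) * bell d
  count-FirstCutAt-≡ k d refl = count-FirstCutAt k d

-- Inflationary idempotent maps

private
  score : Bool → ℕ → ℕ
  score true k = suc k
  score false _ = 0

  score-≤ : ∀ x y {k m} → T x → score x k ≤ score y m → T y × k ≤ m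
  score-≤ true true _ (s≤s k≤m) = _ , k≤m
  score-≤ true false _ ()

-- Opaque, since unfolding the search over allFin makes type checking at concrete sizes explode.
opaque
  -- The largest i with S i, or d if there is none.
  greatest : ∀ {n} → (Fin n → Bool) → Fin n → Fin n
  greatest {n} S d = argmax (λ b → score (S b) (toℕ b)) d (allFin n)

  greatest-spec : ∀ {n} (S : Fin n → Bool) d {b} → T (S b) → T (S (greatest S d)) × toℕ b ≤ toℕ (greatest S d)
  greatest-spec {n} S d {b} Sb = score-≤ (S b) (S (greatest S d)) Sb
    (v≤f[argmax]⁺ d (allFin n) (inj₂ (Any.map (λ { refl → ≤-refl }) (∈-allFin b))))

greatest-satisfies : ∀ {n} (S : Fin n → Bool) d {b} → T (S b) → T (S (greatest S d))
greatest-satisfies S d = proj₁ ∘ greatest-spec S d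

greatest-maximal : ∀ {n} (S : Fin n → Bool) d {b} → T (S b) → toℕ b ≤ toℕ (greatest S d)
greatest-maximal S d = proj₂ ∘ greatest-spec S d

greatest-unique : ∀ {n} (S : Fin n → Bool) d {x} → T (S x) → (∀ b → T (S b) → toℕ b ≤ toℕ x) → greatest S d ≡ x
greatest-unique S d Sx ub = toℕ-injective (≤-antisym (ub _ (greatest-satisfies S d Sx)) (greatest-maximal S d Sx))

Endo : ℕ → Set
Endo n = Vec (Fin n) n

allEndos : ∀ n → List (Endo n)
allEndos n = allVecs (allFin n) n

∈-allEndos : ∀ {n} (m : Endo n) → m ∈ allEndos n
∈-allEndos = ∈-allVecs ∈-allFin

allEndos-unique : ∀ n → Unique (allEndos n)
allEndos-unique n = allVecs-unique (Unique.allFin⁺ n) n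

-- A set partition is recorded by sending each element to the maximum of its block.
record IsInflationaryIdempotent {n} (m : Endo n) : Set where
  field
    inflationary : ∀ a → toℕ a ≤ toℕ (lookup m a)
    idempotent : ∀ a → lookup m (lookup m a) ≡ lookup m a

isInflationaryIdempotent : ∀ {n} → Endo n → Bool
isInflationaryIdempotent {n} m =
  all (λ a → not (toℕ (lookup m a) <ᵇ toℕ a) ∧ (toℕ (lookup m (lookup m a)) ≡ᵇ toℕ (lookup m a))) (allFin n)

isInflationaryIdempotent-sound : ∀ {n} (m : Endo n) → T (isInflationaryIdempotent m) → IsInflationaryIdempotent m
isInflationaryIdempotent-sound m h = record
  { inflationary = λ a → ≮⇒≥ λ lt → T-not⁻ (proj₁ (T-∧⁻ (all-allFin⁻ _ h a))) (<⇒<ᵇ lt)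
  ; idempotent = λ a → toℕ-≡ᵇ⁻ (proj₂ (T-∧⁻ {not (toℕ (lookup m a) <ᵇ toℕ a)} (all-allFin⁻ _ h a)))
  }

isInflationaryIdempotent-complete : ∀ {n} (m : Endo n) → IsInflationaryIdempotent m → T (isInflationaryIdempotent m)
isInflationaryIdempotent-complete m M = all-allFin⁺ _ λ a →
  T-∧⁺ (T-not⁺ λ t → <⇒≱ (<ᵇ⇒< _ _ t) (inflationary a)) (toℕ-≡ᵇ⁺ (idempotent a))
  where open IsInflationaryIdempotent M

MapCut : ∀ {n} → Endo n → ℕ → Set
MapCut m c = ∀ a → toℕ a < c → toℕ (lookup m a) < c

isMapCut : ∀ {n} → Endo n → ℕ → Bool
isMapCut {n} m c = all (λ a → not (toℕ a <ᵇ c) ∨ (toℕ (lookup m a) <ᵇ c)) (allFin n)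

isMapCut-sound : ∀ {n} (m : Endo n) c → T (isMapCut m c) → MapCut m c
isMapCut-sound m c h a a< = <ᵇ⇒< _ _ (T-imp⁻ (all-allFin⁻ _ h a) (<⇒<ᵇ a<))

isMapCut-complete : ∀ {n} (m : Endo n) c → MapCut m c → T (isMapCut m c)
isMapCut-complete m c h = all-allFin⁺ _ λ a → T-imp⁺ λ t → <⇒<ᵇ (h a (<ᵇ⇒< _ _ t))

isAtomicMap : ∀ {n} → Endo n → Bool
isAtomicMap {zero} m = false
isAtomicMap {suc n} m = not (any (λ i → isMapCut m (suc i)) (upTo n))

AtomicMap : ∀ {n} → Endo n → Bool
AtomicMap m = isInflationaryIdempotent m ∧ isAtomicMap m

atomicMapCount : ℕ → ℕ
atomicMapCount n = count AtomicMap (allEndos n)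

isAtomic-cong : ∀ {n} {R : Relation n} {m : Endo n} →
  (∀ c → Cut R c → MapCut m c) → (∀ c → MapCut m c → Cut R c) → isAtomic R ≡ isAtomicMap m
isAtomic-cong {zero} _ _ = refl
isAtomic-cong {suc n} {R} {m} to from = cong not (any-cong _ _ (upTo n) λ i _ → T-extensional
  (λ t → isMapCut-complete m (suc i) (to (suc i) (isCut-sound R (suc i) t)))
  (λ t → isCut-complete R (suc i) (from (suc i) (isMapCut-sound m (suc i) t))))

blockMax : ∀ {n} → Relation n → Endo n
blockMax R = tabulate λ a → greatest (related R a) a

kernel : ∀ {n} → Endo n → Relation n
kernel m = tabulate λ a → tabulate λ b → toℕ (lookup m a) ≡ᵇ toℕ (lookup m b)

module _ {n} (m : Endo n) where
  related-kernel : ∀ a b → related (kernel m) a b ≡ (toℕ (lookup m a) ≡ᵇ toℕ (lookup m b))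
  related-kernel = related-tabulate (λ a b → toℕ (lookup m a) ≡ᵇ toℕ (lookup m b))

  related-kernel⁺ : ∀ {a b} → lookup m a ≡ lookup m b → T (related (kernel m) a b)
  related-kernel⁺ {a} {b} e = subst T (sym (related-kernel a b)) (toℕ-≡ᵇ⁺ e)

  related-kernel⁻ : ∀ {a b} → T (related (kernel m) a b) → lookup m a ≡ lookup m b
  related-kernel⁻ {a} {b} t = toℕ-≡ᵇ⁻ (subst T (related-kernel a b) t)

  kernel-IsEquivRel : IsEquivRel (kernel m)
  kernel-IsEquivRel = record
    { reflexive = λ a → related-kernel⁺ refl
    ; symmetric = λ a b t → related-kernel⁺ (sym (related-kernel⁻ t))
    ; transitive = λ a b c t u → related-kernel⁺ (trans (related-kernel⁻ t) (related-kernel⁻ u))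
    }

module _ {n} (R : Relation n) (E : IsEquivRel R) where
  open IsEquivRel E

  lookup-blockMax : ∀ a → lookup (blockMax R) a ≡ greatest (related R a) a
  lookup-blockMax a = lookup∘tabulate _ a

  related-blockMax : ∀ a → T (related R a (lookup (blockMax R) a))
  related-blockMax a = subst (T ∘ related R a) (sym (lookup-blockMax a)) (greatest-satisfies (related R a) a (reflexive a))

  blockMax-≡ : ∀ a b → T (related R a b) → lookup (blockMax R) a ≡ lookup (blockMax R) b
  blockMax-≡ a b r = begin
    lookup (blockMax R) a            ≡⟨ lookup-blockMax a ⟩
    greatest (related R a) a         ≡⟨ greatest-unique (related R a) a Rab′ ub ⟩
    greatest (related R b) b         ≡⟨ lookup-blockMax b ⟨
    lookup (blockMax R) b            ∎
    where
    Rab′ : T (related R a (greatest (related R b) b))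
    Rab′ = transitive a b _ r (greatest-satisfies (related R b) b (reflexive b))
    ub : ∀ x → T (related R a x) → toℕ x ≤ toℕ (greatest (related R b) b)
    ub x Rax = greatest-maximal (related R b) b (transitive b a x (symmetric a b r) Rax)

  blockMax-≡⁻ : ∀ a b → lookup (blockMax R) a ≡ lookup (blockMax R) b → T (related R a b)
  blockMax-≡⁻ a b e = transitive a _ b (related-blockMax a) (symmetric b _ (subst (T ∘ related R b) (sym e) (related-blockMax b)))

  blockMax-IsInflationaryIdempotent : IsInflationaryIdempotent (blockMax R)
  blockMax-IsInflationaryIdempotent = record
    { inflationary = λ a → subst (λ x → toℕ a ≤ toℕ x) (sym (lookup-blockMax a)) (greatest-maximal (related R a) a (reflexive a))
    ; idempotent = λ a → sym (blockMax-≡ a _ (related-blockMax a))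
    }

  isAtomic-blockMax : isAtomic R ≡ isAtomicMap (blockMax R)
  isAtomic-blockMax = isAtomic-cong to from
    where
    to : ∀ c → Cut R c → MapCut (blockMax R) c
    to c cut a a< = ≰⇒> λ c≤ → cut a _ a< c≤ (related-blockMax a)
    from : ∀ c → MapCut (blockMax R) c → Cut R c
    from c cut a b a< c≤b r = <⇒≱ (cut a a<)
      (subst (λ x → c ≤ toℕ x) (sym (blockMax-≡ a b r)) (≤-trans c≤b (IsInflationaryIdempotent.inflationary blockMax-IsInflationaryIdempotent b)))

  kernel-blockMax : kernel (blockMax R) ≡ R
  kernel-blockMax = relation-ext _ _ λ a b → T-extensional
    (λ t → blockMax-≡⁻ a b (related-kernel⁻ (blockMax R) t))
    (λ r → related-kernel⁺ (blockMax R) (blockMax-≡ a b r))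

module _ {n} (m : Endo n) (M : IsInflationaryIdempotent m) where
  open IsInflationaryIdempotent M

  -- m a is the largest element of the block {b | m b = m a}.
  blockMax-kernel : blockMax (kernel m) ≡ m
  blockMax-kernel = lookup-ext _ _ λ a → trans (lookup-blockMax (kernel m) (kernel-IsEquivRel m) a)
    (greatest-unique (related (kernel m) a) a (related-kernel⁺ m (sym (idempotent a)))
      λ b t → subst (λ x → toℕ b ≤ toℕ x) (sym (related-kernel⁻ m t)) (inflationary b))

atomicCount≡atomicMapCount : ∀ n → atomicCount n ≡ atomicMapCount n
atomicCount≡atomicMapCount n = count-bijection _ AtomicMap
  (allRelations-unique n) (allEndos-unique n) ∈-allRelations ∈-allEndos blockMax valid injective surjective
  where
  valid : ∀ R → T (isEquivRel R ∧ isAtomic R) → T (AtomicMap (blockMax R))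
  valid R h = T-∧⁺ (isInflationaryIdempotent-complete _ (blockMax-IsInflationaryIdempotent R E))
                   (subst T (isAtomic-blockMax R E) (proj₂ (T-∧⁻ {isEquivRel R} h)))
    where
    E : IsEquivRel R
    E = isEquivRel-sound R (proj₁ (T-∧⁻ h))
  injective : ∀ {R R′} → T (isEquivRel R ∧ isAtomic R) → T (isEquivRel R′ ∧ isAtomic R′) → blockMax R ≡ blockMax R′ → R ≡ R′
  injective {R} {R′} h h′ e = begin
    R                     ≡⟨ kernel-blockMax R (isEquivRel-sound R (proj₁ (T-∧⁻ h))) ⟨
    kernel (blockMax R)   ≡⟨ cong kernel e ⟩
    kernel (blockMax R′)  ≡⟨ kernel-blockMax R′ (isEquivRel-sound R′ (proj₁ (T-∧⁻ h′))) ⟩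
    R′                    ∎
  surjective : ∀ m → T (AtomicMap m) → ∃ λ R → T (isEquivRel R ∧ isAtomic R) × blockMax R ≡ m
  surjective m h = kernel m , T-∧⁺ (isEquivRel-complete _ E) atomic , blockMax-kernel m M
    where
    M : IsInflationaryIdempotent m
    M = isInflationaryIdempotent-sound m (proj₁ (T-∧⁻ h))
    E : IsEquivRel (kernel m)
    E = kernel-IsEquivRel m
    atomic : T (isAtomic (kernel m))
    atomic = subst T (sym (trans (isAtomic-blockMax (kernel m) E) (cong isAtomicMap (blockMax-kernel m M))))
                     (proj₂ (T-∧⁻ {isInflationaryIdempotent m} h))

-- Permutations and their left maxima

pigeonholeℕ : ∀ k (h : Fin (suc k) → ℕ) → (∀ x → h x < k) → ∃₂ λ x y → x ≢ y × h x ≡ h y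
pigeonholeℕ k h h< with pigeonhole (n<1+n k) (λ x → fromℕ< (h< x))
... | x , y , x<y , e = x , y , (λ { refl → <-irrefl refl x<y }) , (begin
  h x                   ≡⟨ toℕ-fromℕ< (h< x) ⟨
  toℕ (fromℕ< (h< x))   ≡⟨ cong toℕ e ⟩
  toℕ (fromℕ< (h< y))   ≡⟨ toℕ-fromℕ< (h< y) ⟩
  h y                   ∎)

IsPerm : ∀ {n} → Endo n → Set
IsPerm v = ∀ i j → lookup v i ≡ lookup v j → i ≡ j

isPerm-sound : ∀ {n} (v : Endo n) → T (isPerm v) → IsPerm v
isPerm-sound v h i j e with T-∨⁻ (all-allFin⁻ _ (all-allFin⁻ _ h i) j)
... | inj₁ t = toℕ-≡ᵇ⁻ t
... | inj₂ t = contradiction (toℕ-≡ᵇ⁺ e) (T-not⁻ t)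

isPerm-complete : ∀ {n} (v : Endo n) → IsPerm v → T (isPerm v)
isPerm-complete v P = all-allFin⁺ _ λ i → all-allFin⁺ _ λ j → distinct i j
  where
  distinct : ∀ i j → T ((toℕ i ≡ᵇ toℕ j) ∨ not (toℕ (lookup v i) ≡ᵇ toℕ (lookup v j)))
  distinct i j with toℕ i ≡ᵇ toℕ j in e
  ... | true = _
  ... | false = T-not⁺ λ t → subst T e (toℕ-≡ᵇ⁺ (P i j (toℕ-≡ᵇ⁻ t)))

IsPerm-surjective : ∀ {n} (v : Endo n) → IsPerm v → ∀ a → ∃ λ p → lookup v p ≡ a
IsPerm-surjective {n} v P a with any (λ p → toℕ (lookup v p) ≡ᵇ toℕ a) (allFin n) in e
... | true = let p , t = any-allFin⁻ _ (subst T (sym e) _) in p , toℕ-≡ᵇ⁻ t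
-- If a were missed, punching it out would inject Fin (k + 1) into Fin k.
IsPerm-surjective {suc k} v P a | false = ⊥-elim (injective-collision (pigeonhole (n<1+n k) (λ x → punchOut (missed x))))
  where
  missed : ∀ x → a ≢ lookup v x
  missed x eq = subst T e (any-allFin⁺ _ x (toℕ-≡ᵇ⁺ (sym eq)))
  injective-collision : (∃₂ λ i j → i Fin.< j × punchOut (missed i) ≡ punchOut (missed j)) → ⊥
  injective-collision (i , j , i<j , eq) = <-irrefl (cong toℕ (P i j (punchOut-injective (missed i) (missed j) eq))) i<j

position : ∀ {n} → Endo n → Fin n → Fin n
position v a = greatest (λ p → toℕ (lookup v p) ≡ᵇ toℕ a) a

leftMax : ∀ {n} → Endo n → Fin n → Fin n
leftMax v a = greatest (λ b → not (toℕ (position v a) <ᵇ toℕ (position v b))) a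

leftMaxes : ∀ {n} → Endo n → Endo n
leftMaxes v = tabulate (leftMax v)

InitialPrefix : ∀ {n} → Endo n → ℕ → Set
InitialPrefix v i = (∀ p → toℕ p < i → toℕ (lookup v p) < i) × (∀ a → toℕ a < i → ∃ λ p → toℕ p < i × lookup v p ≡ a)

prefixIsInitial-sound : ∀ {n} (v : Endo n) i → T (prefixIsInitial v i) → InitialPrefix v i
prefixIsInitial-sound {n} v i h =
  (λ p p< → <ᵇ⇒< _ _ (T-imp⁻ (all-allFin⁻ _ values-h p) (<⇒<ᵇ p<))) ,
  (λ a a< → witness (any-allFin⁻ _ (T-imp⁻ (all-allFin⁻ _ (proj₂ (T-∧⁻ {values} h)) a) (<⇒<ᵇ a<))))
  where
  values : Bool
  values = all (λ p → not (toℕ p <ᵇ i) ∨ (toℕ (lookup v p) <ᵇ i)) (allFin n)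
  values-h : T values
  values-h = proj₁ (T-∧⁻ {values} h)
  witness : ∀ {a} → (∃ λ p → T ((toℕ p <ᵇ i) ∧ (toℕ (lookup v p) ≡ᵇ toℕ a))) → ∃ λ p → toℕ p < i × lookup v p ≡ a
  witness (p , t) = p , <ᵇ⇒< _ _ (proj₁ (T-∧⁻ t)) , toℕ-≡ᵇ⁻ (proj₂ (T-∧⁻ {toℕ p <ᵇ i} t))

prefixIsInitial-complete : ∀ {n} (v : Endo n) i → InitialPrefix v i → T (prefixIsInitial v i)
prefixIsInitial-complete v i (values , letters) =
  T-∧⁺ (all-allFin⁺ _ λ p → T-imp⁺ λ t → <⇒<ᵇ (values p (<ᵇ⇒< _ _ t)))
       (all-allFin⁺ _ λ a → T-imp⁺ λ t → let p , p< , e = letters a (<ᵇ⇒< _ _ t)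
                                          in any-allFin⁺ _ p (T-∧⁺ (<⇒<ᵇ p<) (toℕ-≡ᵇ⁺ e)))

module _ {n} (v : Endo n) (P : IsPerm v) where
  private
    π : Fin n → Fin n
    π = lookup v
    pos : Fin n → Fin n
    pos = position v
    occursAt : Fin n → Fin n → Bool
    occursAt a p = toℕ (π p) ≡ᵇ toℕ a
    notAfter : Fin n → Fin n → Bool
    notAfter a b = not (toℕ (pos a) <ᵇ toℕ (pos b))

  lookup-position : ∀ a → π (pos a) ≡ a
  lookup-position a = toℕ-≡ᵇ⁻ (greatest-satisfies (occursAt a) a (toℕ-≡ᵇ⁺ (proj₂ (IsPerm-surjective v P a))))

  position-lookup : ∀ p → pos (π p) ≡ p
  position-lookup p = P _ _ (lookup-position (π p))

  position-injective : ∀ a b → pos a ≡ pos b → a ≡ b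
  position-injective a b e = trans (sym (lookup-position a)) (trans (cong π e) (lookup-position b))

  private
    atOrBefore : ∀ {a b} → toℕ (pos b) ≤ toℕ (pos a) → T (notAfter a b)
    atOrBefore le = T-not⁺ λ t → <⇒≱ (<ᵇ⇒< _ _ t) le

    atOrBefore⁻ : ∀ {a b} → T (notAfter a b) → toℕ (pos b) ≤ toℕ (pos a)
    atOrBefore⁻ t = ≮⇒≥ λ lt → T-not⁻ t (<⇒<ᵇ lt)

  position-leftMax≤ : ∀ a → toℕ (pos (leftMax v a)) ≤ toℕ (pos a)
  position-leftMax≤ a = atOrBefore⁻ (greatest-satisfies (notAfter a) a (atOrBefore {a} ≤-refl))

  leftMax-maximal : ∀ a b → toℕ (pos b) ≤ toℕ (pos a) → toℕ b ≤ toℕ (leftMax v a)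
  leftMax-maximal a b le = greatest-maximal (notAfter a) a (atOrBefore le)

  leftMax-unique : ∀ a x → toℕ (pos x) ≤ toℕ (pos a) → (∀ b → toℕ (pos b) ≤ toℕ (pos a) → toℕ b ≤ toℕ x) → leftMax v a ≡ x
  leftMax-unique a x le ub = greatest-unique (notAfter a) a (atOrBefore le) (λ b t → ub b (atOrBefore⁻ t))

  lookup-leftMaxes : ∀ a → lookup (leftMaxes v) a ≡ leftMax v a
  lookup-leftMaxes = lookup∘tabulate (leftMax v)

  leftMaxes-IsInflationaryIdempotent : IsInflationaryIdempotent (leftMaxes v)
  leftMaxes-IsInflationaryIdempotent = record
    { inflationary = λ a → subst (λ x → toℕ a ≤ toℕ x) (sym (lookup-leftMaxes a)) (leftMax-maximal a a ≤-refl)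
    ; idempotent = λ a → begin
        lookup (leftMaxes v) (lookup (leftMaxes v) a) ≡⟨ trans (lookup-leftMaxes _) (cong (leftMax v) (lookup-leftMaxes a)) ⟩
        leftMax v (leftMax v a)                       ≡⟨ idempotent a ⟩
        leftMax v a                                   ≡⟨ lookup-leftMaxes a ⟨
        lookup (leftMaxes v) a                        ∎
    }
    where
    idempotent : ∀ a → leftMax v (leftMax v a) ≡ leftMax v a
    idempotent a = leftMax-unique (leftMax v a) (leftMax v a) ≤-refl
      (λ b le → leftMax-maximal a b (≤-trans le (position-leftMax≤ a)))

  InitialPrefix⇒MapCut : ∀ i → InitialPrefix v i → MapCut (leftMaxes v) i
  InitialPrefix⇒MapCut i (values , letters) a a< with letters a a<
  ... | p , p< , refl = subst (λ x → toℕ x < i) (trans (lookup-position _) (sym (lookup-leftMaxes (π p))))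
          (values _ (≤-<-trans (position-leftMax≤ (π p)) (subst (λ q → toℕ q < i) (sym (position-lookup p)) p<)))

  -- If the letters below i are all ruled by left maxima below i, then they occupy the first i positions:
  -- otherwise i + 1 positions would carry letters below i.
  MapCut⇒position< : ∀ i → MapCut (leftMaxes v) i → ∀ a → toℕ a < i → toℕ (pos a) < i
  MapCut⇒position< i cut a a< = ≰⇒> λ i≤ → collision i≤ (pigeonholeℕ i (h i≤) (h< i≤))
    where
    module _ (i≤ : i ≤ toℕ (pos a)) where
      i<n : suc i ≤ n
      i<n = ≤-<-trans i≤ (toℕ<n (pos a))
      early : Fin (suc i) → Fin n
      early x = inject≤ x i<n
      h : Fin (suc i) → ℕ
      h x = toℕ (π (early x))
      h< : ∀ x → h x < i
      h< x = ≤-<-trans (leftMax-maximal a (π (early x)) early-pos) (subst (λ y → toℕ y < i) (lookup-leftMaxes a) (cut a a<))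
        where
        early-pos : toℕ (pos (π (early x))) ≤ toℕ (pos a)
        early-pos = subst (λ q → toℕ q ≤ toℕ (pos a)) (sym (position-lookup (early x)))
          (subst (_≤ toℕ (pos a)) (sym (toℕ-inject≤ x i<n)) (≤-trans (≤-pred (toℕ<n x)) i≤))
      collision : (∃₂ λ x y → x ≢ y × h x ≡ h y) → ⊥
      collision (x , y , x≢y , e) = x≢y (toℕ-injective (begin
        toℕ x         ≡⟨ toℕ-inject≤ x i<n ⟨
        toℕ (early x) ≡⟨ cong toℕ (P _ _ (toℕ-injective e)) ⟩
        toℕ (early y) ≡⟨ toℕ-inject≤ y i<n ⟩
        toℕ y         ∎))

  MapCut⇒InitialPrefix : ∀ i → i ≤ n → MapCut (leftMaxes v) i → InitialPrefix v i
  MapCut⇒InitialPrefix i i≤n cut = values , λ a a< → pos a , early a a< , lookup-position a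
    where
    early : ∀ a → toℕ a < i → toℕ (pos a) < i
    early = MapCut⇒position< i cut
    small : Fin i → Fin n
    small x = inject≤ x i≤n
    -- Positions of the i letters below i, together with p: i + 1 values below i.
    h : Fin n → Fin (suc i) → ℕ
    h p Fin.zero = toℕ p
    h p (Fin.suc x) = toℕ (pos (small x))
    h< : ∀ p → toℕ p < i → ∀ x → h p x < i
    h< p p< Fin.zero = p<
    h< p p< (Fin.suc x) = early (small x) (subst (_< i) (sym (toℕ-inject≤ x i≤n)) (toℕ<n x))
    position-small-injective : ∀ x y → toℕ (pos (small x)) ≡ toℕ (pos (small y)) → x ≡ y
    position-small-injective x y e = toℕ-injective (begin
      toℕ x         ≡⟨ toℕ-inject≤ x i≤n ⟨
      toℕ (small x) ≡⟨ cong toℕ (position-injective _ _ (toℕ-injective e)) ⟩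
      toℕ (small y) ≡⟨ toℕ-inject≤ y i≤n ⟩
      toℕ y         ∎)
    small-letter : ∀ p x → toℕ p ≡ toℕ (pos (small x)) → toℕ (π p) < i
    small-letter p x e = subst (λ q → toℕ q < i)
      (sym (trans (cong π (toℕ-injective e)) (lookup-position (small x))))
      (subst (_< i) (sym (toℕ-inject≤ x i≤n)) (toℕ<n x))
    values : ∀ p → toℕ p < i → toℕ (π p) < i
    values p p< with pigeonholeℕ i (h p) (h< p p<)
    ... | Fin.zero , Fin.zero , 0≢0 , _ = contradiction refl 0≢0
    ... | Fin.zero , Fin.suc y , _ , e = small-letter p y e
    ... | Fin.suc x , Fin.zero , _ , e = small-letter p x (sym e)
    ... | Fin.suc x , Fin.suc y , x≢y , e = contradiction (cong Fin.suc (position-small-injective x y e)) x≢y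

isIndecomposable-leftMaxes : ∀ {n} (v : Endo n) → IsPerm v → isIndecomposable v ≡ isAtomicMap (leftMaxes v)
isIndecomposable-leftMaxes {zero} v P = refl
isIndecomposable-leftMaxes {suc n} v P =
  cong not (any-cong (λ i → prefixIsInitial v (suc i)) (λ i → isMapCut (leftMaxes v) (suc i)) (upTo n) same-cuts)
  where
  same-cuts : ∀ i → i ∈ upTo n → prefixIsInitial v (suc i) ≡ isMapCut (leftMaxes v) (suc i)
  same-cuts i i∈ = T-extensional
    (λ t → isMapCut-complete (leftMaxes v) (suc i) (InitialPrefix⇒MapCut v P (suc i) (prefixIsInitial-sound v (suc i) t)))
    (λ t → prefixIsInitial-complete v (suc i)
             (MapCut⇒InitialPrefix v P (suc i) (s≤s (<⇒≤ (∈-upTo⁻ i∈))) (isMapCut-sound (leftMaxes v) (suc i) t)))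

-- Avoiders sorted by key

Occurrence : Pattern → ∀ {n} → Endo n → Set
Occurrence σ {n} v = ∃ λ (j : Fin n) → ∃₂ λ (k k′ : Fin n) →
  toℕ j < toℕ k × toℕ k′ ≡ suc (toℕ k) × T (occ σ (toℕ (lookup v j)) (toℕ (lookup v k)) (toℕ (lookup v k′)))

avoids-sound : ∀ σ {n} (v : Endo n) → T (avoids σ v) → ¬ Occurrence σ v
avoids-sound σ v h (j , k , k′ , j<k , k′≡ , t) =
  T-not⁻ h (any-allFin⁺ _ j (any-allFin⁺ _ k (any-allFin⁺ _ k′ (T-∧⁺ (<⇒<ᵇ j<k) (T-∧⁺ (≡⇒≡ᵇ _ _ k′≡) t)))))

avoids-complete : ∀ σ {n} (v : Endo n) → ¬ Occurrence σ v → T (avoids σ v)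
avoids-complete σ {n} v h = T-not⁺ λ t →
  let j , t₁ = any-allFin⁻ _ t
      k , t₂ = any-allFin⁻ _ t₁
      k′ , t₃ = any-allFin⁻ _ t₂
      j<k , rest = T-∧⁻ t₃
      k′≡ , o = T-∧⁻ {toℕ k′ ≡ᵇ suc (toℕ k)} rest
  in h (j , k , k′ , <ᵇ⇒< _ _ j<k , ≡ᵇ⇒≡ _ _ k′≡ , o)

lex-< : ∀ {N x y r s} → r < N → x < y → x * N + r < y * N + s
lex-< {N} {x} {y} {r} {s} r<N x<y = <-≤-trans (+-monoʳ-< (x * N) r<N)
  (≤-trans (≤-reflexive (+-comm (x * N) N)) (≤-trans (*-monoˡ-≤ N x<y) (m≤m+n (y * N) s)))

-- Inside a block (fibre of M), the rank orders the letters as a σ-avoider lists them: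
-- decreasingly for 3_12; the maximum first and then increasingly for 3_21.
rank : Pattern → ∀ {n} → (Fin n → Fin n) → Fin n → ℕ
rank p3-12 {n} M a = n ∸ toℕ a
rank p3-21 M a = if toℕ a ≡ᵇ toℕ (M a) then 0 else suc (toℕ a)

rank< : ∀ σ {n} (M : Fin n → Fin n) a → rank σ M a < suc n
rank< p3-12 {n} M a = s≤s (m∸n≤m n (toℕ a))
rank< p3-21 M a with toℕ a ≡ᵇ toℕ (M a)
... | true = s≤s z≤n
... | false = s≤s (toℕ<n a)

rank-p3-21 : ∀ {n} (M : Fin n → Fin n) a →
  (a ≡ M a × rank p3-21 M a ≡ 0) ⊎ (a ≢ M a × rank p3-21 M a ≡ suc (toℕ a))
rank-p3-21 M a with toℕ a ≡ᵇ toℕ (M a) in e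
... | true = inj₁ (toℕ-≡ᵇ⁻ (subst T (sym e) _) , refl)
... | false = inj₂ ((λ a≡ → subst T e (toℕ-≡ᵇ⁺ a≡)) , refl)

-- The pair (M a, rank a) in lexicographic order, encoded in ℕ using rank a ≤ n.
key : Pattern → ∀ {n} → (Fin n → Fin n) → Fin n → ℕ
key σ {n} M a = toℕ (M a) * suc n + rank σ M a

module _ (σ : Pattern) {n} (M : Fin n → Fin n) where
  private
    κ : Fin n → ℕ
    κ = key σ M
    ρ : Fin n → ℕ
    ρ = rank σ M

  key-≤⇒≤ : ∀ a b → κ a ≤ κ b → toℕ (M a) ≤ toℕ (M b)
  key-≤⇒≤ a b le = ≮⇒≥ λ Mb<Ma → <⇒≱ (lex-< (rank< σ M b) Mb<Ma) le

  <⇒key-< : ∀ a b → toℕ (M a) < toℕ (M b) → κ a < κ b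
  <⇒key-< a b = lex-< (rank< σ M a)

  key-≤⇒rank-≤ : ∀ a b → M a ≡ M b → κ a ≤ κ b → ρ a ≤ ρ b
  key-≤⇒rank-≤ a b e le = +-cancelˡ-≤ (toℕ (M a) * suc n) _ _ (subst (λ x → κ a ≤ toℕ x * suc n + ρ b) (sym e) le)

  rank-≤⇒key-≤ : ∀ a b → M a ≡ M b → ρ a ≤ ρ b → κ a ≤ κ b
  rank-≤⇒key-≤ a b e le = subst (λ x → κ a ≤ toℕ x * suc n + ρ b) e (+-monoʳ-≤ (toℕ (M a) * suc n) le)

  key-injective : ∀ a b → κ a ≡ κ b → a ≡ b
  key-injective a b e = same-rank σ refl (≤-antisym (key-≤⇒rank-≤ a b Ma≡Mb (≤-reflexive e)) (key-≤⇒rank-≤ b a (sym Ma≡Mb) (≤-reflexive (sym e))))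
    where
    Ma≡Mb : M a ≡ M b
    Ma≡Mb = toℕ-injective (≤-antisym (key-≤⇒≤ a b (≤-reflexive e)) (key-≤⇒≤ b a (≤-reflexive (sym e))))
    same-rank : ∀ σ′ → σ′ ≡ σ → rank σ′ M a ≡ rank σ′ M b → a ≡ b
    same-rank p3-12 refl r = toℕ-injective (∸-cancelˡ-≡ (<⇒≤ (toℕ<n a)) (<⇒≤ (toℕ<n b)) r)
    same-rank p3-21 refl r with rank-p3-21 M a | rank-p3-21 M b
    ... | inj₁ (a≡ , _) | inj₁ (b≡ , _) = trans a≡ (trans Ma≡Mb (sym b≡))
    ... | inj₂ (_ , ra) | inj₂ (_ , rb) = toℕ-injective (suc-injective (trans (sym ra) (trans r rb)))
    ... | inj₁ (_ , ra) | inj₂ (_ , rb) = ⊥-elim (0≢1+n (trans (sym ra) (trans r rb)))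
    ... | inj₂ (_ , ra) | inj₁ (_ , rb) = ⊥-elim (0≢1+n (trans (sym rb) (trans (sym r) ra)))

  key-block-maximum≤ : (∀ a → toℕ a ≤ toℕ (M a)) → (∀ a → M (M a) ≡ M a) → ∀ a → κ (M a) ≤ κ a
  key-block-maximum≤ inflationary idempotent a = rank-≤⇒key-≤ (M a) a (idempotent a) (rank-maximum σ refl)
    where
    rank-maximum : ∀ σ′ → σ′ ≡ σ → rank σ′ M (M a) ≤ rank σ′ M a
    rank-maximum p3-12 refl = ∸-monoʳ-≤ n (inflationary a)
    rank-maximum p3-21 refl with rank-p3-21 M (M a)
    ... | inj₁ (_ , r0) = subst (_≤ rank p3-21 M a) (sym r0) z≤n
    ... | inj₂ (Ma≢ , _) = ⊥-elim (Ma≢ (sym (idempotent a)))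

KeySorted : Pattern → ∀ {n} → (Fin n → Fin n) → Endo n → Set
KeySorted σ M τ = ∀ p q → toℕ p ≤ toℕ q → key σ M (lookup τ p) ≤ key σ M (lookup τ q)

module KeySortedPermutation (σ : Pattern) {n} (M : Fin n → Fin n)
  (inflationary : ∀ a → toℕ a ≤ toℕ (M a)) (idempotent : ∀ a → M (M a) ≡ M a)
  (τ : Endo n) (P : IsPerm τ) (sorted : KeySorted σ M τ) where

  private
    π : Fin n → Fin n
    π = lookup τ
    pos : Fin n → Fin n
    pos = position τ
    κ : Fin n → ℕ
    κ = key σ M

  key-strictly-increasing : ∀ p q → toℕ p < toℕ q → κ (π p) < κ (π q)
  key-strictly-increasing p q p<q =
    ≤∧≢⇒< (sorted p q (<⇒≤ p<q)) λ e → <-irrefl (cong toℕ (P p q (key-injective σ M _ _ e))) p<q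

  key-≤⇒position-≤ : ∀ a b → κ a ≤ κ b → toℕ (pos a) ≤ toℕ (pos b)
  key-≤⇒position-≤ a b le = ≮⇒≥ λ later → <⇒≱ (key-strictly-increasing (pos b) (pos a) later)
    (subst₂ (λ x y → κ x ≤ κ y) (sym (lookup-position τ P a)) (sym (lookup-position τ P b)) le)

  position-≤⇒key-≤ : ∀ a b → toℕ (pos a) ≤ toℕ (pos b) → κ a ≤ κ b
  position-≤⇒key-≤ a b le = subst₂ (λ x y → κ x ≤ κ y) (lookup-position τ P a) (lookup-position τ P b) (sorted (pos a) (pos b) le)

  leftMax-keySorted : ∀ a → leftMax τ a ≡ M a
  leftMax-keySorted a = leftMax-unique τ P a (M a)
    (key-≤⇒position-≤ (M a) a (key-block-maximum≤ σ M inflationary idempotent a))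
    (λ b le → ≤-trans (inflationary b) (key-≤⇒≤ σ M b a (position-≤⇒key-≤ b a le)))

  next-key≤ : ∀ k k′ → toℕ k′ ≡ suc (toℕ k) → ∀ x → κ (π k) < κ x → κ (π k′) ≤ κ x
  next-key≤ k k′ k′≡ x lt = subst (λ y → κ (π k′) ≤ κ y) (lookup-position τ P x)
    (sorted k′ (pos x) (subst (_≤ toℕ (pos x)) (sym k′≡)
      (≰⇒> λ le → <⇒≱ lt (subst (λ y → κ y ≤ κ (π k)) (lookup-position τ P x) (sorted (pos x) k le)))))

  module _ (j k k′ : Fin n) (j<k : toℕ j < toℕ k) (k′≡ : toℕ k′ ≡ suc (toℕ k)) where
    private
      e : Fin n
      e = π j
      a : Fin n
      a = π k
      c : Fin n
      c = π k′

    key-a<c : κ a < κ c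
    key-a<c = key-strictly-increasing k k′ (subst (toℕ k <_) (sym k′≡) ≤-refl)

    key-e≤a : κ e ≤ κ a
    key-e≤a = sorted j k (<⇒≤ j<k)

    M-e≤a : toℕ e ≤ toℕ (M a)
    M-e≤a = ≤-trans (inflationary e) (key-≤⇒≤ σ M e a key-e≤a)

    M-a≤c : toℕ (M a) ≤ toℕ (M c)
    M-a≤c = key-≤⇒≤ σ M a c (<⇒≤ key-a<c)

    block-starts : toℕ (M a) < toℕ (M c) → M c ≡ c
    block-starts lt = key-injective σ M _ _ (≤-antisym (key-block-maximum≤ σ M inflationary idempotent c)
      (next-key≤ k k′ k′≡ (M c) (<⇒key-< σ M a (M c) (subst (λ x → toℕ (M a) < toℕ x) (sym (idempotent c)) lt))))

    no-3-12 : σ ≡ p3-12 → toℕ a < toℕ c → toℕ c < toℕ e → ⊥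
    no-3-12 refl a<c c<e = <-asym c<e (≤-<-trans M-e≤a (subst (λ x → toℕ (M a) < toℕ x) (block-starts Ma<Mc) Ma<Mc))
      where
      Ma<Mc : toℕ (M a) < toℕ (M c)
      Ma<Mc with m≤n⇒m<n∨m≡n M-a≤c
      ... | inj₁ lt = lt
      ... | inj₂ eq = ⊥-elim (<⇒≱ (∸-monoʳ-< a<c (<⇒≤ (toℕ<n c))) (key-≤⇒rank-≤ σ M a c (toℕ-injective eq) (<⇒≤ key-a<c)))

    no-3-21 : σ ≡ p3-21 → toℕ c < toℕ a → toℕ a < toℕ e → ⊥
    no-3-21 refl c<a a<e with m≤n⇒m<n∨m≡n M-a≤c
    ... | inj₁ lt = <-irrefl refl (<-≤-trans c<a (≤-trans (inflationary a) (<⇒≤ (subst (λ x → toℕ (M a) < toℕ x) (block-starts lt) lt))))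
    ... | inj₂ eq = <⇒≱ a<e (subst (λ x → toℕ e ≤ toℕ x) (sym a-maximum) M-e≤a)
      where
      a-maximum : a ≡ M a
      a-maximum with rank-p3-21 M a | rank-p3-21 M c
      ... | inj₁ (a≡ , _) | _ = a≡
      ... | inj₂ _ | inj₁ (c≡ , _) = ⊥-elim (<⇒≱ c<a (subst (λ x → toℕ a ≤ toℕ x) (sym c≡) (subst (λ x → toℕ a ≤ toℕ x) (toℕ-injective eq) (inflationary a))))
      ... | inj₂ (_ , ra) | inj₂ (_ , rc) =
        ⊥-elim (<⇒≱ c<a (≤-pred (subst₂ _≤_ ra rc (key-≤⇒rank-≤ σ M a c (toℕ-injective eq) (<⇒≤ key-a<c)))))

  keySorted-avoids : ¬ Occurrence σ τ
  keySorted-avoids (j , k , k′ , j<k , k′≡ , t) = by-pattern σ refl t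
    where
    by-pattern : ∀ σ′ → σ′ ≡ σ → T (occ σ′ (toℕ (π j)) (toℕ (π k)) (toℕ (π k′))) → ⊥
    by-pattern p3-12 σ≡ t′ = no-3-12 j k k′ j<k k′≡ (sym σ≡) (<ᵇ⇒< _ _ (proj₁ (T-∧⁻ t′))) (<ᵇ⇒< _ _ (proj₂ (T-∧⁻ {toℕ (π k) <ᵇ toℕ (π k′)} t′)))
    by-pattern p3-21 σ≡ t′ = no-3-21 j k k′ j<k k′≡ (sym σ≡) (<ᵇ⇒< _ _ (proj₁ (T-∧⁻ t′))) (<ᵇ⇒< _ _ (proj₂ (T-∧⁻ {toℕ (π k′) <ᵇ toℕ (π k)} t′)))

module Avoider (σ : Pattern) {n} (v : Endo n) (P : IsPerm v) (avoids : ¬ Occurrence σ v) where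
  private
    π : Fin n → Fin n
    π = lookup v
    pos : Fin n → Fin n
    pos = position v
    m : Fin n → Fin n
    m = leftMax v
    κ : Fin n → ℕ
    κ = key σ m

  module _ (k k′ : Fin n) (k′≡ : toℕ k′ ≡ suc (toℕ k)) where
    private
      a : Fin n
      a = π k
      c : Fin n
      c = π k′

    k<k′ : toℕ k < toℕ k′
    k<k′ = subst (toℕ k <_) (sym k′≡) ≤-refl

    a≢c : toℕ a ≢ toℕ c
    a≢c e = <-irrefl (cong toℕ (P k k′ (toℕ-injective e))) k<k′

    position-leftMax-a≤k : toℕ (pos (m a)) ≤ toℕ k
    position-leftMax-a≤k = subst (λ z → toℕ (pos (m a)) ≤ toℕ z) (position-lookup v P k) (position-leftMax≤ v P a)

    at-or-before-c : ∀ b → toℕ (pos b) ≤ toℕ (pos c) → toℕ (pos b) ≤ toℕ k ⊎ b ≡ c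
    at-or-before-c b le with m≤n⇒m<n∨m≡n (subst (λ z → toℕ (pos b) ≤ toℕ z) (position-lookup v P k′) le)
    ... | inj₁ lt = inj₁ (≤-pred (subst (toℕ (pos b) <_) k′≡ lt))
    ... | inj₂ eq = inj₂ (trans (sym (lookup-position v P b)) (cong π (toℕ-injective eq)))

    leftMax-same : toℕ c ≤ toℕ (m a) → m c ≡ m a
    leftMax-same le = leftMax-unique v P c (m a)
      (subst (λ z → toℕ (pos (m a)) ≤ toℕ z) (sym (position-lookup v P k′)) (≤-trans position-leftMax-a≤k (<⇒≤ k<k′)))
      λ b lb → [ (λ le′ → leftMax-maximal v P a b (subst (λ z → toℕ (pos b) ≤ toℕ z) (sym (position-lookup v P k)) le′))
               , (λ { refl → le }) ]′ (at-or-before-c b lb)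

    leftMax-new : toℕ (m a) < toℕ c → m c ≡ c
    leftMax-new lt = leftMax-unique v P c c ≤-refl
      λ b lb → [ (λ le′ → <⇒≤ (≤-<-trans (leftMax-maximal v P a b (subst (λ z → toℕ (pos b) ≤ toℕ z) (sym (position-lookup v P k)) le′)) lt))
               , (λ { refl → ≤-refl }) ]′ (at-or-before-c b lb)

    rising-new-block : toℕ (m a) < toℕ c → κ a ≤ κ c
    rising-new-block lt = <⇒≤ (<⇒key-< σ m a c (subst (λ z → toℕ (m a) < toℕ z) (sym (leftMax-new lt)) lt))

    before-k-below : ∀ y → (∀ j → toℕ j < toℕ k → y < toℕ (π j) → Occurrence σ v) → (∀ j → toℕ j < toℕ k → toℕ (π j) ≢ y) →
      ∀ j → toℕ j < toℕ k → toℕ (π j) < y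
    before-k-below y occurrence distinct j j<k = ≤∧≢⇒< (≮⇒≥ λ y<πj → avoids (occurrence j j<k y<πj)) (distinct j j<k)

    adjacent-3-12 : σ ≡ p3-12 → κ a ≤ κ c
    adjacent-3-12 refl with <-cmp (toℕ a) (toℕ c)
    ... | tri≈ _ e _ = ⊥-elim (a≢c e)
    ... | tri> _ _ c<a = rank-≤⇒key-≤ σ m a c (sym (leftMax-same (≤-trans (<⇒≤ c<a) (leftMax-maximal v P a a ≤-refl)))) (∸-monoʳ-≤ n (<⇒≤ c<a))
    ... | tri< a<c _ _ = rising-new-block leftMax-a<c
      where
      below-c : ∀ j → toℕ j < toℕ k → toℕ (π j) < toℕ c
      below-c = before-k-below (toℕ c) (λ j j<k c<πj → j , k , k′ , j<k , k′≡ , T-∧⁺ (<⇒<ᵇ a<c) (<⇒<ᵇ c<πj))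
        (λ j j<k e → <-irrefl (cong toℕ (P j k′ (toℕ-injective e))) (<-trans j<k k<k′))
      leftMax-a<c : toℕ (m a) < toℕ c
      leftMax-a<c with m≤n⇒m<n∨m≡n position-leftMax-a≤k
      ... | inj₁ lt = subst (λ z → toℕ z < toℕ c) (lookup-position v P (m a)) (below-c (pos (m a)) lt)
      ... | inj₂ eq = subst (λ z → toℕ z < toℕ c) (trans (cong π (sym (toℕ-injective eq))) (lookup-position v P (m a))) a<c

    adjacent-3-21 : σ ≡ p3-21 → κ a ≤ κ c
    adjacent-3-21 refl with <-cmp (toℕ a) (toℕ c)
    ... | tri≈ _ e _ = ⊥-elim (a≢c e)
    ... | tri> _ _ c<a = rank-≤⇒key-≤ σ m a c (sym (leftMax-same (subst (λ z → toℕ c ≤ toℕ z) (sym leftMax-a≡a) (<⇒≤ c<a)))) rank-a≤c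
      where
      below-a : ∀ j → toℕ j < toℕ k → toℕ (π j) < toℕ a
      below-a = before-k-below (toℕ a) (λ j j<k a<πj → j , k , k′ , j<k , k′≡ , T-∧⁺ (<⇒<ᵇ c<a) (<⇒<ᵇ a<πj))
        (λ j j<k e → <-irrefl (cong toℕ (P j k (toℕ-injective e))) j<k)
      leftMax-a≡a : m a ≡ a
      leftMax-a≡a = leftMax-unique v P a a ≤-refl λ b lb → earlier b (m≤n⇒m<n∨m≡n lb)
        where
        earlier : ∀ b → toℕ (pos b) < toℕ (pos a) ⊎ toℕ (pos b) ≡ toℕ (pos a) → toℕ b ≤ toℕ a
        earlier b (inj₁ lt) = <⇒≤ (subst (λ z → toℕ z < toℕ a) (lookup-position v P b)
                                    (below-a (pos b) (subst (λ z → toℕ (pos b) < toℕ z) (position-lookup v P k) lt)))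
        earlier b (inj₂ eq) = ≤-reflexive (cong toℕ (position-injective v P b a (toℕ-injective eq)))
      rank-a≤c : rank σ m a ≤ rank σ m c
      rank-a≤c with rank-p3-21 m a
      ... | inj₁ (_ , r0) = subst (_≤ rank σ m c) (sym r0) z≤n
      ... | inj₂ (a≢ , _) = ⊥-elim (a≢ (sym leftMax-a≡a))
    ... | tri< a<c _ _ with <-cmp (toℕ (m a)) (toℕ c)
    ...   | tri< lt _ _ = rising-new-block lt
    ...   | tri≈ _ e _ = ⊥-elim (<⇒≱ k<k′ (subst (λ z → toℕ z ≤ toℕ k) (trans (cong pos (toℕ-injective e)) (position-lookup v P k′)) position-leftMax-a≤k))
    ...   | tri> _ _ c<ma = rank-≤⇒key-≤ σ m a c (sym same) rank-a≤c
      where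
      same : m c ≡ m a
      same = leftMax-same (<⇒≤ c<ma)
      rank-a≤c : rank σ m a ≤ rank σ m c
      rank-a≤c with rank-p3-21 m a | rank-p3-21 m c
      ... | inj₁ (_ , r0) | _ = subst (_≤ rank σ m c) (sym r0) z≤n
      ... | inj₂ _ | inj₁ (c≡ , _) = ⊥-elim (<-irrefl (cong toℕ (trans c≡ same)) c<ma)
      ... | inj₂ (_ , ra) | inj₂ (_ , rc) = subst₂ _≤_ (sym ra) (sym rc) (s≤s (<⇒≤ a<c))

  avoider-keySorted-adjacent : ∀ k k′ → toℕ k′ ≡ suc (toℕ k) → κ (π k) ≤ κ (π k′)
  avoider-keySorted-adjacent k k′ k′≡ = by-pattern σ refl
    where
    by-pattern : ∀ σ′ → σ′ ≡ σ → κ (π k) ≤ κ (π k′)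
    by-pattern p3-12 σ≡ = adjacent-3-12 k k′ k′≡ (sym σ≡)
    by-pattern p3-21 σ≡ = adjacent-3-21 k k′ k′≡ (sym σ≡)

Linked-tabulate : ∀ {A : Set} (R : A → A → Set) {m} (f : Fin m → A) →
  (∀ (k k′ : Fin m) → toℕ k′ ≡ suc (toℕ k) → R (f k) (f k′)) → Linked R (List.tabulate f)
Linked-tabulate R {zero} f adjacent = []
Linked-tabulate R {suc zero} f adjacent = [-]
Linked-tabulate R {suc (suc m)} f adjacent =
  adjacent Fin.zero (Fin.suc Fin.zero) refl ∷ Linked-tabulate R (f ∘ Fin.suc) (λ k k′ e → adjacent (Fin.suc k) (Fin.suc k′) (cong suc e))

lookup-injective : ∀ {A : Set} {xs : List A} → Unique xs → ∀ i j → List.lookup xs i ≡ List.lookup xs j → i ≡ j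
lookup-injective (_ ∷ _) Fin.zero Fin.zero e = refl
lookup-injective (x∉ ∷ _) Fin.zero (Fin.suc j) e = ⊥-elim (All.lookup x∉ (∈-lookup j) e)
lookup-injective (x∉ ∷ _) (Fin.suc i) Fin.zero e = ⊥-elim (All.lookup x∉ (∈-lookup i) (sym e))
lookup-injective (_ ∷ u) (Fin.suc i) (Fin.suc j) e = cong Fin.suc (lookup-injective u i j e)

tabulate-lookup-↭ : ∀ {n} (τ : Endo n) → IsPerm τ → List.tabulate (lookup τ) ↭ allFin n
tabulate-lookup-↭ {n} τ P = ∼bag⇒↭ (unique∧set⇒bag (Unique.tabulate⁺ (P _ _)) (Unique.allFin⁺ n) (mk⇔ (λ _ → ∈-allFin _) onto))
  where
  onto : ∀ {x} → x ∈ allFin n → x ∈ List.tabulate (lookup τ)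
  onto {x} _ with IsPerm-surjective τ P x
  ... | p , refl = ∈-tabulate⁺ p

key-cong : ∀ σ {n} {M M′ : Fin n → Fin n} → (∀ a → M a ≡ M′ a) → ∀ a → key σ M a ≡ key σ M′ a
key-cong p3-12 e a rewrite e a = refl
key-cong p3-21 e a rewrite e a = refl

module Sorting (σ : Pattern) {n} (M : Fin n → Fin n) where
  private
    κ : Fin n → ℕ
    κ = key σ M
    order : DecTotalOrder _ _ _
    order = On.decTotalOrder ≤-decTotalOrder κ
    open module S = Sort order using (sort; sort-↭; sort-↗)
    totalOrder : TotalOrder _ _ _
    totalOrder = DecTotalOrder.totalOrder order

  KeySortedAdjacent : Endo n → Set
  KeySortedAdjacent τ = ∀ k k′ → toℕ k′ ≡ suc (toℕ k) → κ (lookup τ k) ≤ κ (lookup τ k′)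

  keySorted-unique : ∀ τ τ′ → IsPerm τ → IsPerm τ′ → KeySortedAdjacent τ → KeySortedAdjacent τ′ → τ ≡ τ′
  keySorted-unique τ τ′ P P′ A A′ = lookup-ext τ τ′ λ i → key-injective σ M _ _ (Pointwise.tabulate⁻ same-keys i)
    where
    same-keys : Pointwise (λ x y → κ x ≡ κ y) (List.tabulate (lookup τ)) (List.tabulate (lookup τ′))
    same-keys = ↗↭↗⇒≋ totalOrder (Linked-tabulate _ (lookup τ) A) (Linked-tabulate _ (lookup τ′) A′)
      (↭⇒↭ₛ′ (DecTotalOrder.Eq.isEquivalence order) (↭-trans (tabulate-lookup-↭ τ P) (↭-sym (tabulate-lookup-↭ τ′ P′))))

  private
    sorted : List (Fin n)
    sorted = sort (allFin n)

    length-sorted : length sorted ≡ n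
    length-sorted = trans (↭-length (sort-↭ (allFin n))) (length-tabulate (λ i → i))

    sorted-unique : Unique sorted
    sorted-unique = Permutationₛ.Unique-resp-↭ (setoid (Fin n)) (↭⇒↭ₛ (↭-sym (sort-↭ (allFin n)))) (Unique.allFin⁺ n)

    at : Fin n → Fin (length sorted)
    at = cast (sym length-sorted)

  keySort : Endo n
  keySort = tabulate λ p → List.lookup sorted (at p)

  private
    lookup-keySort : ∀ p → lookup keySort p ≡ List.lookup sorted (at p)
    lookup-keySort = lookup∘tabulate _

  keySort-IsPerm : IsPerm keySort
  keySort-IsPerm p q e = toℕ-injective (trans (sym (toℕ-cast _ p)) (trans (cong toℕ
    (lookup-injective sorted-unique _ _ (trans (sym (lookup-keySort p)) (trans e (lookup-keySort q))))) (toℕ-cast _ q)))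

  keySort-KeySorted : KeySorted σ M keySort
  keySort-KeySorted p q le = subst₂ (λ x y → κ x ≤ κ y) (sym (lookup-keySort p)) (sym (lookup-keySort q))
    (lookup-mono-≤ totalOrder (sort-↗ (allFin n)) (subst₂ _≤_ (sym (toℕ-cast _ p)) (sym (toℕ-cast _ q)) le))

avoiderCount≡atomicMapCount : ∀ σ n → I σ n ≡ atomicMapCount n
avoiderCount≡atomicMapCount σ n = count-bijection IndecomposableAvoider AtomicMap
  (allEndos-unique n) (allEndos-unique n) ∈-allEndos ∈-allEndos leftMaxes valid injective surjective
  where
  IndecomposableAvoider : Endo n → Bool
  IndecomposableAvoider v = isPerm v ∧ isIndecomposable v ∧ avoids σ v

  parts : ∀ v → T (IndecomposableAvoider v) → IsPerm v × T (isIndecomposable v) × T (avoids σ v)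
  parts v h = let p , rest = T-∧⁻ {isPerm v} h in isPerm-sound v p , T-∧⁻ {isIndecomposable v} rest

  adjacent-sorted : ∀ v → T (IndecomposableAvoider v) → Sorting.KeySortedAdjacent σ (lookup (leftMaxes v)) v
  adjacent-sorted v h k k′ k′≡ = subst₂ _≤_ (same-key (lookup v k)) (same-key (lookup v k′))
    (Avoider.avoider-keySorted-adjacent σ v P (avoids-sound σ v avoid) k k′ k′≡)
    where
    P : IsPerm v
    P = proj₁ (parts v h)
    avoid : T (avoids σ v)
    avoid = proj₂ (proj₂ (parts v h))
    same-key : ∀ a → key σ (leftMax v) a ≡ key σ (lookup (leftMaxes v)) a
    same-key = key-cong σ (λ a → sym (lookup-leftMaxes v P a))

  valid : ∀ v → T (IndecomposableAvoider v) → T (AtomicMap (leftMaxes v))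
  valid v h = let P , indecomposable , _ = parts v h in
    T-∧⁺ (isInflationaryIdempotent-complete _ (leftMaxes-IsInflationaryIdempotent v P))
         (subst T (isIndecomposable-leftMaxes v P) indecomposable)

  injective : ∀ {v v′} → T (IndecomposableAvoider v) → T (IndecomposableAvoider v′) → leftMaxes v ≡ leftMaxes v′ → v ≡ v′
  injective {v} {v′} h h′ e = Sorting.keySorted-unique σ (lookup (leftMaxes v)) v v′
    (proj₁ (parts v h)) (proj₁ (parts v′ h′)) (adjacent-sorted v h)
    (subst (λ m → Sorting.KeySortedAdjacent σ (lookup m) v′) (sym e) (adjacent-sorted v′ h′))

  surjective : ∀ m → T (AtomicMap m) → ∃ λ v → T (IndecomposableAvoider v) × leftMaxes v ≡ m
  surjective m h = τ , T-∧⁺ (isPerm-complete τ P) (T-∧⁺ indecomposable (avoids-complete σ τ K.keySorted-avoids)) , leftMaxes-τ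
    where
    M : IsInflationaryIdempotent m
    M = isInflationaryIdempotent-sound m (proj₁ (T-∧⁻ h))
    open IsInflationaryIdempotent M
    open Sorting σ (lookup m)
    τ : Endo n
    τ = keySort
    P : IsPerm τ
    P = keySort-IsPerm
    module K = KeySortedPermutation σ (lookup m) inflationary idempotent τ P keySort-KeySorted
    leftMaxes-τ : leftMaxes τ ≡ m
    leftMaxes-τ = lookup-ext _ _ λ a → trans (lookup-leftMaxes τ P a) (K.leftMax-keySorted a)
    indecomposable : T (isIndecomposable τ)
    indecomposable = subst T (sym (trans (isIndecomposable-leftMaxes τ P) (cong isAtomicMap leftMaxes-τ)))
                             (proj₂ (T-∧⁻ {isInflationaryIdempotent m} h))

theorem4p7 : ((n : ℕ) → bell n ≡ δ₀ n + IB p3-12 n)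
           × ((n : ℕ) → bell n ≡ δ₀ n + IB p3-21 n)
theorem4p7 = bell-coefficient p3-12 , bell-coefficient p3-21
  where
  bell-coefficient : ∀ σ n → bell n ≡ δ₀ n + IB σ n
  bell-coefficient σ zero = refl
  bell-coefficient σ (suc n) = begin
    bell (suc n)
      ≡⟨ bell-suc n ⟩
    sum (applyUpTo (λ k → atomicCount (suc k) * bell (n ∸ k)) (suc n))
      ≡⟨ sum-applyUpTo-cong _ _ (suc n) (λ k _ → cong (_* bell (n ∸ k)) (atomicCount≡I (suc k))) ⟩
    sum (applyUpTo (λ k → I σ (suc k) * bell (n ∸ k)) (suc n))
      ≡⟨ cong sum (map-applyUpTo id (λ k → I σ (suc k) * bell (suc n ∸ suc k)) (suc n)) ⟨
    IB σ (suc n) ∎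
    where
    atomicCount≡I : ∀ k → atomicCount k ≡ I σ k
    atomicCount≡I k = trans (atomicCount≡atomicMapCount k) (sym (avoiderCount≡atomicMapCount σ k))
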